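{- Let $F$ and $G$ be forests with $\mathsf{ted}(F,G)\le k$ and let $\mathcal{D}$ be a piece decomposition of $F$. Then there exists a piece matching $\mathcal{M}$ between $\mathcal{D}$ and $G$ such that at most $2k$ pieces of $\mathcal{D}$ are unmatched and the characters of $G$ not contained in any matched piece form at most $4k$ (maximal) fragments of $G$.
   Context: Forests over $\Sigma$ are balanced strings over $\{(_a,)_a:a\in\Sigma\}$; $\mathrm{mate}_F(i)$ is the position matched with $F[i]$. $\mathsf{ted}(F,G)$ is the unweighted tree edit distance: the minimum cost of a forest alignment of $F$ onto $G$, i.e. a monotone lattice path from $(0,0)$ to $(|F|,|G|)$ with steps $(1,0)$ (delete $F[x]$, cost $\tfrac12$), $(0,1)$ (insert $G[y]$, cost $\tfrac12$), $(1,1)$ (align $F[x]$ with $G[y]$, cost $0$ if same label, $\tfrac12$ otherwise), such that whenever $F[f]$ is aligned with $G[g]$ also $F[\mathrm{mate}_F(f)]$ is aligned with $G[\mathrm{mate}_G(g)]$; its width is $\max|x-y|$ over its vertices. A piece of $F$ is a subforest (balanced fragment $F[i..j)$) or a context $\langle F[i..i');F[j'..j)\rangle$ with $i<i'\le j'<j$, $F[i],F[j-1]$ matching parentheses and $F[i'..j')$ balanced. A piece decomposition of a balanced fragment $F[i..j)$ is a set $\mathcal{D}$ of pieces defined recursively: $\mathcal{D}=\emptyset$ if $i=j$; or $\mathcal{D}=\{F[i..j)\}$ if $i<j$; or $\mathcal{D}=\mathcal{D}_L\cup\mathcal{D}_R$ with $\mathcal{D}_L,\mathcal{D}_R$ piece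 decompositions of $F[i..m)$ and $F[m..j)$ for some $m\in(i..j)$; or $\mathcal{D}=\{\langle F[i..i');F[j'..j)\rangle\}\cup\mathcal{D}'$ for a context $\langle F[i..i');F[j'..j)\rangle$ and a piece decomposition $\mathcal{D}'$ of $F[i'..j')$. A piece decomposition of $F$ is one of $F[0..|F|)$. A piece matching between $\mathcal{D}$ and $G$ (threshold $k$) is a set $\mathcal{M}\subseteq\mathcal{D}\times\{\text{pieces of }G\}$ whose first components are pairwise disjoint, such that some forest alignment of $F$ onto $G$ of width at most $2k$ matches each $f$ to its partner $g$ perfectly (equal strings, corresponding characters aligned). -}

module Defs where

open import Data.Nat using (ℕ; zero; suc; _+_; _*_; _∸_; _≤_; _<_; ∣_-_∣)
open import Data.List using (List; []; _∷_; _++_; length; take; drop; map)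
open import Data.List.Membership.Propositional using (_∈_; _∉_)
open import Data.List.Relation.Unary.Unique.Propositional using (Unique)
open import Data.Maybe using (Maybe; just; nothing)
open import Data.Product using (Σ; ∃; _×_; _,_; proj₁; proj₂)
open import Data.Sum using (_⊎_)
open import Data.Empty using (⊥)
open import Relation.Binary.PropositionalEquality using (_≡_)
open import Relation.Binary.Definitions using (DecidableEquality)
open import Relation.Nullary using (yes; no)

data Paren (A : Set) : Set where
  op : A → Paren A
  cl : A → Paren A

label : {A : Set} → Paren A → A
label (op a) = a
label (cl a) = a

-- balanced strings (forests)
data Bal {A : Set} : List (Paren A) → Set where
  nil  : Bal []
  node : ∀ {xs ys} (a : A) → Bal xs → Bal ys → Bal (op a ∷ xs ++ cl a ∷ ys)

at : {X : Set} → List X → ℕ → Maybe X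
at []       _       = nothing
at (x ∷ xs) zero    = just x
at (x ∷ xs) (suc i) = at xs i

frag : {X : Set} → List X → ℕ → ℕ → List X
frag F i j = take (j ∸ i) (drop i F)

BalFrag : {A : Set} → List (Paren A) → ℕ → ℕ → Set
BalFrag F i j = i ≤ j × j ≤ length F × Bal (frag F i j)

Matched : {A : Set} → List (Paren A) → ℕ → ℕ → Set
Matched F i j = i < j × j < length F ×
  Σ _ λ a → at F i ≡ just (op a) × at F j ≡ just (cl a) × Bal (frag F (suc i) j)

Mate : {A : Set} → List (Paren A) → ℕ → ℕ → Set
Mate F i j = Matched F i j ⊎ Matched F j i

data Step : Set where
  del ins ali : Step    -- (1,0), (0,1), (1,1)

tagged : ℕ → ℕ → List Step → List (ℕ × ℕ × Step)
tagged x y []         = []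
tagged x y (del ∷ s)  = (x , y , del) ∷ tagged (suc x) y s
tagged x y (ins ∷ s)  = (x , y , ins) ∷ tagged x (suc y) s
tagged x y (ali ∷ s)  = (x , y , ali) ∷ tagged (suc x) (suc y) s

verts : ℕ → ℕ → List Step → List (ℕ × ℕ)
verts x y []         = (x , y) ∷ []
verts x y (del ∷ s)  = (x , y) ∷ verts (suc x) y s
verts x y (ins ∷ s)  = (x , y) ∷ verts x (suc y) s
verts x y (ali ∷ s)  = (x , y) ∷ verts (suc x) (suc y) s

endpoint : ℕ → ℕ → List Step → ℕ × ℕ
endpoint x y []         = (x , y)
endpoint x y (del ∷ s)  = endpoint (suc x) y s
endpoint x y (ins ∷ s)  = endpoint x (suc y) s
endpoint x y (ali ∷ s)  = endpoint (suc x) (suc y) s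

Aligned : List Step → ℕ → ℕ → Set
Aligned P x y = (x , y , ali) ∈ tagged 0 0 P

record IsAlignment {A : Set} (F G : List (Paren A)) (P : List Step) : Set where
  field
    ends    : endpoint 0 0 P ≡ (length F , length G)
    consist : ∀ f g f' g' → Aligned P f g → Mate F f f' → Mate G g g' → Aligned P f' g'

WidthAtMost : List Step → ℕ → Set
WidthAtMost P w = ∀ x y → (x , y) ∈ verts 0 0 P → ∣ x - y ∣ ≤ w

-- twice the cost of an alignment (costs are multiples of 1/2)
module _ {A : Set} (_≟_ : DecidableEquality A) where

  stepCost2 : Step → Maybe (Paren A) → Maybe (Paren A) → ℕ
  stepCost2 ali (just p) (just q) with label p ≟ label q
  ... | yes _ = 0
  ... | no  _ = 1
  stepCost2 _ _ _ = 1

  cost2 : List (Paren A) → List (Paren A) → List (ℕ × ℕ × Step) → ℕ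
  cost2 F G []                 = 0
  cost2 F G ((x , y , s) ∷ ts) = stepCost2 s (at F x) (at G y) + cost2 F G ts

  TedAtMost : List (Paren A) → List (Paren A) → ℕ → Set
  TedAtMost F G k = Σ (List Step) λ P →
    IsAlignment F G P × cost2 F G (tagged 0 0 P) ≤ 2 * k

data Piece : Set where
  sub : ℕ → ℕ → Piece
  ctx : ℕ → ℕ → ℕ → ℕ → Piece

IsContext : {A : Set} → List (Paren A) → ℕ → ℕ → ℕ → ℕ → Set
IsContext F i i' j' j = i < i' × i' ≤ j' × j' < j × j ≤ length F ×
  Matched F i (j ∸ 1) × BalFrag F i' j'

IsPiece : {A : Set} → List (Paren A) → Piece → Set
IsPiece F (sub i j)        = BalFrag F i j
IsPiece F (ctx i i' j' j)  = IsContext F i i' j' j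

data PieceDecomp {A : Set} (F : List (Paren A)) : ℕ → ℕ → List Piece → Set where
  empty : ∀ {i} → BalFrag F i i → PieceDecomp F i i []
  whole : ∀ {i j} → i < j → BalFrag F i j → PieceDecomp F i j (sub i j ∷ [])
  split : ∀ {i m j DL DR} → i < m → m < j → BalFrag F i m → BalFrag F m j →
          PieceDecomp F i m DL → PieceDecomp F m j DR → PieceDecomp F i j (DL ++ DR)
  wrap  : ∀ {i i' j' j D} → IsContext F i i' j' j → PieceDecomp F i' j' D →
          PieceDecomp F i j (ctx i i' j' j ∷ D)

PerfectMatch : {A : Set} → List (Paren A) → List (Paren A) → List Step → Piece → Piece → Set
PerfectMatch F G P (sub i j) (sub a b) =
  frag F i j ≡ frag G a b × (∀ t → t < j ∸ i → Aligned P (i + t) (a + t))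
PerfectMatch F G P (ctx i i' j' j) (ctx a a' b' b) =
  frag F i i' ≡ frag G a a' × frag F j' j ≡ frag G b' b ×
  (∀ t → t < i' ∸ i → Aligned P (i + t) (a + t)) ×
  (∀ t → t < j ∸ j' → Aligned P (j' + t) (b' + t))
PerfectMatch F G P _ _ = ⊥

IsPieceMatching : {A : Set} → List (Paren A) → List (Paren A) → ℕ →
                  List Piece → List (Piece × Piece) → Set
IsPieceMatching F G k D M =
  (∀ {f g} → (f , g) ∈ M → f ∈ D × IsPiece G g) ×
  Unique (map proj₁ M) ×
  Σ (List Step) λ P → IsAlignment F G P × WidthAtMost P (2 * k) ×
    (∀ {f g} → (f , g) ∈ M → PerfectMatch F G P f g)

InPiece : ℕ → Piece → Set
InPiece y (sub a b)        = a ≤ y × y < b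
InPiece y (ctx a a' b' b)  = (a ≤ y × y < a') ⊎ (b' ≤ y × y < b)

Uncovered : List (Piece × Piece) → ℕ → Set
Uncovered M y = ∀ {f g} → (f , g) ∈ M → InPiece y g → ⊥

InSomeFragment : ℕ → List (ℕ × ℕ) → Set
InSomeFragment y I = Σ (ℕ × ℕ) λ se → se ∈ I × proj₁ se ≤ y × y < proj₂ se

module Submission where

-- Fix an alignment P of cost at most k; its width never exceeds the cost spent so far.
-- Call a piece hit if a costly step of P consumes one of its characters or inserts strictly
-- inside one of its arms. An unhit piece is traversed by a diagonal run of free alignments,
-- which copies it onto an identical piece of G (for a context, consistency of P makes the image
-- of its outer pair a matched pair and the image of its hole balanced); we match exactly the
-- unhit pieces. Arms of distinct pieces are disjoint, so a costly step hits at most one piece: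
-- at most 2k pieces are unmatched. A maximal uncovered fragment of G is entered either by an
-- insertion outside every arm or by a step starting an arm of a hit piece; charging it to the
-- insertion, or to the hitting step together with the arm, is injective, giving at most 4k.

open import Defs
open import Data.Nat using (ℕ; zero; suc; _+_; _*_; _∸_; _≤_; _<_; z≤n; s≤s; _≤?_; _<?_; ∣_-_∣; ⌊_/2⌋)
  renaming (_≟_ to _≟ℕ_)
open import Data.Nat.Properties hiding (_≟_; _≤?_; _<?_)
open import Data.Nat.Tactic.RingSolver using (solve-∀)
open import Data.Bool using (Bool; true; false)
open import Data.List using (List; []; _∷_; _++_; length; take; drop; map; filter; upTo; deduplicate)
open import Data.List.Properties using (++-assoc; length-++; length-map; take++drop≡id; take-[]; ∷-injectiveʳ)
open import Data.List.Membership.Propositional using (_∈_; _∉_; find; lose; mapWith∈)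
open import Data.List.Membership.Propositional.Properties
  using (∈-++⁻; ∈-++⁺ˡ; ∈-++⁺ʳ; ∈-filter⁺; ∈-filter⁻; ∈-map⁺; ∈-map⁻; ∈-upTo⁺; ∈-upTo⁻; ∈-deduplicate⁺; ∈-deduplicate⁻;
         map-mapWith∈; mapWith∈-id)
open import Data.List.Relation.Unary.Any using (here; there; any?)
open import Data.List.Relation.Unary.Any.Properties using (mapWith∈⁺; mapWith∈⁻)
import Data.List.Relation.Unary.All as All
open import Data.List.Relation.Unary.Unique.Propositional using (Unique; []; _∷_)
open import Data.List.Relation.Unary.Unique.Propositional.Properties using (upTo⁺) renaming (filter⁺ to Unique-filter⁺)
open import Data.List.Relation.Unary.Unique.DecPropositional.Properties using (deduplicate-!)
open import Data.Maybe using (Maybe; just; nothing)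
open import Data.Product using (Σ; ∃; _×_; _,_; proj₁; proj₂)
open import Data.Sum using (_⊎_; inj₁; inj₂; [_,_]′)
open import Data.Empty using (⊥; ⊥-elim)
open import Function using (_⇔_; mk⇔; _∘_)
open import Relation.Binary.PropositionalEquality
open import Relation.Binary.Definitions using (DecidableEquality; tri<; tri≈; tri>)
open import Relation.Nullary using (yes; no; ¬_; Dec; ¬?)
open import Relation.Nullary.Decidable using (_×-dec_; _⊎-dec_)

module _ {X : Set} where

  []≢++∷ : ∀ (t : List X) x xs → [] ≢ t ++ x ∷ xs
  []≢++∷ []      _ _ ()
  []≢++∷ (_ ∷ _) _ _ ()

  length≡0⇒[] : ∀ (t : List X) → length t ≡ 0 → t ≡ []
  length≡0⇒[] [] _ = refl

  at-++-length : ∀ (L : List X) c R → at (L ++ c ∷ R) (length L) ≡ just c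
  at-++-length []      c R = refl
  at-++-length (x ∷ L) c R = at-++-length L c R

  at-just⇒< : ∀ (S : List X) p {c} → at S p ≡ just c → p < length S
  at-just⇒< (x ∷ S) zero    e = s≤s z≤n
  at-just⇒< (x ∷ S) (suc p) e = s≤s (at-just⇒< S p e)

  <⇒at-just : ∀ (S : List X) p → p < length S → ∃ λ c → at S p ≡ just c
  <⇒at-just (x ∷ S) zero    _         = x , refl
  <⇒at-just (x ∷ S) (suc p) (s≤s lt) = <⇒at-just S p lt

  at-just⇒split : ∀ (S : List X) p {c} → at S p ≡ just c → ∃ λ L → ∃ λ R → S ≡ L ++ c ∷ R × length L ≡ p
  at-just⇒split (x ∷ S) zero    refl = [] , S , refl , refl
  at-just⇒split (x ∷ S) (suc p) e with at-just⇒split S p e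
  ... | L , R , refl , refl = x ∷ L , R , refl , refl

  frag-of-++ : ∀ (L Z R : List X) → frag (L ++ Z ++ R) (length L) (length L + length Z) ≡ Z
  frag-of-++ (x ∷ L) Z R = frag-of-++ L Z R
  frag-of-++ []      Z R = go Z
    where
    go : ∀ Z → take (length Z ∸ 0) (Z ++ R) ≡ Z
    go []      = refl
    go (z ∷ Z) = cong (z ∷_) (go Z)

  length-take-≤ : ∀ (S : List X) i → i ≤ length S → length (take i S) ≡ i
  length-take-≤ S       zero    _         = refl
  length-take-≤ (x ∷ S) (suc i) (s≤s le) = cong suc (length-take-≤ S i le)

  length-frag : ∀ (S : List X) i j → i ≤ j → j ≤ length S → length (frag S i j) ≡ j ∸ i
  length-frag S       zero    j       _          le       = length-take-≤ S j le
  length-frag (x ∷ S) (suc i) (suc j) (s≤s i≤j) (s≤s le) = length-frag S i j i≤j le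

  frag-++ : ∀ (S : List X) i j k → i ≤ j → j ≤ k → frag S i k ≡ frag S i j ++ frag S j k
  frag-++ S       zero    zero    k       _         _         = refl
  frag-++ []      zero    (suc j) (suc k) _         _         = sym (take-[] (k ∸ j))
  frag-++ (x ∷ S) zero    (suc j) (suc k) _         (s≤s j≤k) = cong (x ∷_) (frag-++ S zero j k z≤n j≤k)
  frag-++ []      (suc i) (suc j) (suc k) _         _         =
    trans (take-[] (k ∸ i)) (sym (cong₂ _++_ (take-[] (j ∸ i)) (take-[] (k ∸ j))))
  frag-++ (x ∷ S) (suc i) (suc j) (suc k) (s≤s i≤j) (s≤s j≤k) = frag-++ S i j k i≤j j≤k

  frag-pointwise : ∀ (S S′ : List X) p a m → (∀ t → t < m → at S (p + t) ≡ at S′ (a + t)) →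
                   p + m ≤ length S → a + m ≤ length S′ → frag S p (p + m) ≡ frag S′ a (a + m)
  frag-pointwise S S′ p a m pw le le′ rewrite m+n∸m≡n p m | m+n∸m≡n a m =
    take-pointwise (drop p S) (drop a S′) m
      (λ t lt → trans (at-drop S p t) (trans (pw t lt) (sym (at-drop S′ a t))))
      (≤-length-drop S p le) (≤-length-drop S′ a le′)
    where
    at-drop : ∀ (T : List X) q t → at (drop q T) t ≡ at T (q + t)
    at-drop T       zero    t = refl
    at-drop []      (suc q) t = refl
    at-drop (x ∷ T) (suc q) t = at-drop T q t
    ≤-length-drop : ∀ (T : List X) q {m} → q + m ≤ length T → m ≤ length (drop q T)
    ≤-length-drop T       zero    le        = le
    ≤-length-drop (x ∷ T) (suc q) (s≤s le) = ≤-length-drop T q le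
    take-pointwise : ∀ (T T′ : List X) m → (∀ t → t < m → at T t ≡ at T′ t) →
                     m ≤ length T → m ≤ length T′ → take m T ≡ take m T′
    take-pointwise T       T′       zero    _  _         _          = refl
    take-pointwise (x ∷ T) (y ∷ T′) (suc m) pw (s≤s le) (s≤s le′) with pw 0 (s≤s z≤n)
    ... | refl = cong (x ∷_) (take-pointwise T T′ m (λ t lt → pw (suc t) (s≤s lt)) le le′)

  take++frag≡take : ∀ (S : List X) i j → i ≤ j → take i S ++ frag S i j ≡ take j S
  take++frag≡take S       zero    j       _         = refl
  take++frag≡take []      (suc i) (suc j) _         = take-[] (j ∸ i)
  take++frag≡take (x ∷ S) (suc i) (suc j) (s≤s i≤j) = cong (x ∷_) (take++frag≡take S i j i≤j)

  length-take++frag++frag : ∀ (S : List X) s₀ s₁ s₂ → s₀ ≤ s₁ → s₁ ≤ s₂ → s₂ ≤ length S →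
                            length (take s₀ S ++ frag S s₀ s₁ ++ frag S s₁ s₂) ≡ s₂
  length-take++frag++frag S s₀ s₁ s₂ s₀≤s₁ s₁≤s₂ s₂≤∣S∣ =
    trans (cong length (trans (sym (++-assoc (take s₀ S) _ _))
                         (trans (cong (_++ frag S s₁ s₂) (take++frag≡take S s₀ s₁ s₀≤s₁))
                                (take++frag≡take S s₁ s₂ s₁≤s₂))))
          (length-take-≤ S s₂ s₂≤∣S∣)

  length-crossing≡ : ∀ (L X₀ C M B : List X) x →
    length (L ++ X₀) + suc (length (C ++ M ++ B)) ≡ length (L ++ (X₀ ++ x ∷ C) ++ M) + length B
  length-crossing≡ L X₀ C M B x
    rewrite length-++ L {X₀} | length-++ C {M ++ B} | length-++ M {B} | length-++ L {(X₀ ++ x ∷ C) ++ M}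
          | length-++ (X₀ ++ x ∷ C) {M} | length-++ X₀ {x ∷ C} =
    arith (length L) (length X₀) (length C) (length M) (length B)
    where
    arith : ∀ l x c m b → (l + x) + suc (c + (m + b)) ≡ (l + ((x + suc c) + m)) + b
    arith = solve-∀

  length-crossing< : ∀ (L X₀ C B N B′ : List X) x y →
    length (L ++ X₀) + suc (length (C ++ B)) < length (L ++ (X₀ ++ x ∷ C) ++ (B ++ y ∷ N)) + length B′
  length-crossing< L X₀ C B N B′ x y
    rewrite length-++ L {X₀} | length-++ C {B} | length-++ L {(X₀ ++ x ∷ C) ++ (B ++ y ∷ N)}
          | length-++ (X₀ ++ x ∷ C) {B ++ y ∷ N} | length-++ X₀ {x ∷ C} | length-++ B {y ∷ N} =
    subst (suc ((l + x′) + suc (c + b)) ≤_) (regroup l x′ c b n b′) (m≤m+n _ (n + b′))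
    where
    l x′ c b n b′ : ℕ
    l = length L
    x′ = length X₀
    c = length C
    b = length B
    n = length N
    b′ = length B′
    regroup : ∀ l x c b n b′ → suc ((l + x) + suc (c + b)) + (n + b′) ≡ (l + ((x + suc c) + (b + suc n))) + b′
    regroup = solve-∀

  split-at-four : ∀ (S : List X) f₀ f₁ f₂ f₃ → f₀ ≤ f₁ → f₁ ≤ f₂ → f₂ ≤ f₃ →
    S ≡ take f₀ S ++ frag S f₀ f₁ ++ frag S f₁ f₂ ++ frag S f₂ f₃ ++ drop f₃ S
  split-at-four S f₀ f₁ f₂ f₃ f₀≤f₁ f₁≤f₂ f₂≤f₃ = begin
    S                                    ≡⟨ sym (take++drop≡id f₃ S) ⟩
    take f₃ S ++ D                       ≡⟨ cong (_++ D) (sym (take++frag≡take S f₂ f₃ f₂≤f₃)) ⟩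
    (take f₂ S ++ C) ++ D                ≡⟨ cong (λ T → (T ++ C) ++ D) (sym (take++frag≡take S f₁ f₂ f₁≤f₂)) ⟩
    ((take f₁ S ++ B) ++ C) ++ D         ≡⟨ cong (λ T → ((T ++ B) ++ C) ++ D) (sym (take++frag≡take S f₀ f₁ f₀≤f₁)) ⟩
    (((T₀ ++ A′) ++ B) ++ C) ++ D        ≡⟨ ++-assoc ((T₀ ++ A′) ++ B) C D ⟩
    ((T₀ ++ A′) ++ B) ++ C ++ D          ≡⟨ ++-assoc (T₀ ++ A′) B (C ++ D) ⟩
    (T₀ ++ A′) ++ B ++ C ++ D            ≡⟨ ++-assoc T₀ A′ (B ++ C ++ D) ⟩
    T₀ ++ A′ ++ B ++ C ++ D              ∎
    where
    open ≡-Reasoning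
    T₀ A′ B C D : List X
    T₀ = take f₀ S
    A′ = frag S f₀ f₁
    B  = frag S f₁ f₂
    C  = frag S f₂ f₃
    D  = drop f₃ S

  frag-++-++ : ∀ (S : List X) f₀ f₁ f₂ f₃ → f₀ ≤ f₁ → f₁ ≤ f₂ → f₂ ≤ f₃ →
               frag S f₀ f₃ ≡ frag S f₀ f₁ ++ frag S f₁ f₂ ++ frag S f₂ f₃
  frag-++-++ S f₀ f₁ f₂ f₃ f₀≤f₁ f₁≤f₂ f₂≤f₃ =
    trans (frag-++ S f₀ f₁ f₃ f₀≤f₁ (≤-trans f₁≤f₂ f₂≤f₃)) (cong (frag S f₀ f₁ ++_) (frag-++ S f₁ f₂ f₃ f₁≤f₂ f₂≤f₃))

  ++-reassoc : ∀ (L X₀ C B N W : List X) o c →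
               L ++ (X₀ ++ o ∷ C) ++ (B ++ c ∷ N) ++ W ≡ (L ++ X₀) ++ o ∷ ((C ++ B) ++ c ∷ (N ++ W))
  ++-reassoc (x ∷ L) X₀       C       B N W o c = cong (x ∷_) (++-reassoc L X₀ C B N W o c)
  ++-reassoc []      (x ∷ X₀) C       B N W o c = cong (x ∷_) (++-reassoc [] X₀ C B N W o c)
  ++-reassoc []      []       (x ∷ C) B N W o c = cong (λ T → o ∷ x ∷ T) (∷-injectiveʳ (++-reassoc [] [] C B N W o c))
  ++-reassoc []      []       []      B N W o c = cong (o ∷_) (++-assoc B (c ∷ N) W)


-- The pushdown automaton of the bracket language: S is balanced iff scan S [] ≡ just [].
module Stack {A : Set} (_≟_ : DecidableEquality A) where

  scan : List (Paren A) → List A → Maybe (List A)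
  scan []         st       = just st
  scan (op a ∷ S) st       = scan S (a ∷ st)
  scan (cl a ∷ S) []       = nothing
  scan (cl a ∷ S) (b ∷ st) with a ≟ b
  ... | yes _ = scan S st
  ... | no  _ = nothing

  scan-cl⁻ : ∀ {a b S st r} → scan (cl a ∷ S) (b ∷ st) ≡ just r → a ≡ b × scan S st ≡ just r
  scan-cl⁻ {a} {b} e with a ≟ b
  ... | yes a≡b = a≡b , e

  scan-cl⁺ : ∀ {a S st} → scan (cl a ∷ S) (a ∷ st) ≡ scan S st
  scan-cl⁺ {a} with a ≟ a
  ... | yes _  = refl
  ... | no a≢a = ⊥-elim (a≢a refl)

  scan-++⁻ : ∀ X Y st r → scan (X ++ Y) st ≡ just r → ∃ λ m → scan X st ≡ just m × scan Y m ≡ just r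
  scan-++⁻ []         Y st       r e = st , refl , e
  scan-++⁻ (op a ∷ X) Y st       r e = scan-++⁻ X Y (a ∷ st) r e
  scan-++⁻ (cl a ∷ X) Y (b ∷ st) r e with scan-cl⁻ {S = X ++ Y} e
  ... | refl , e′ with scan-++⁻ X Y st r e′
  ... | m , e₁ , e₂ = m , trans (scan-cl⁺ {S = X}) e₁ , e₂

  scan-++⁺ : ∀ X Y st {m r} → scan X st ≡ just m → scan Y m ≡ just r → scan (X ++ Y) st ≡ just r
  scan-++⁺ []         Y st       refl e₂ = e₂
  scan-++⁺ (op a ∷ X) Y st       e₁   e₂ = scan-++⁺ X Y (a ∷ st) e₁ e₂
  scan-++⁺ (cl a ∷ X) Y (b ∷ st) e₁   e₂ with scan-cl⁻ {S = X} e₁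
  ... | refl , e₁′ = trans (scan-cl⁺ {S = X ++ Y}) (scan-++⁺ X Y st e₁′ e₂)

  Bal⇒scan : ∀ {S} → Bal S → ∀ st → scan S st ≡ just st
  Bal⇒scan nil                      st = refl
  Bal⇒scan (node {xs} {ys} a bx by) st =
    scan-++⁺ xs (cl a ∷ ys) (a ∷ st) (Bal⇒scan bx (a ∷ st)) (trans (scan-cl⁺ {S = ys}) (Bal⇒scan by st))

  opens closes : List (Paren A) → ℕ
  opens []         = 0
  opens (op _ ∷ S) = suc (opens S)
  opens (cl _ ∷ S) = opens S
  closes []         = 0
  closes (op _ ∷ S) = closes S
  closes (cl _ ∷ S) = suc (closes S)

  scan-length : ∀ S st r → scan S st ≡ just r → length st + opens S ≡ length r + closes S
  scan-length []         st       r refl = refl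
  scan-length (op a ∷ S) st       r e    = trans (+-suc (length st) (opens S)) (scan-length S (a ∷ st) r e)
  scan-length (cl a ∷ S) (b ∷ st) r e with scan-cl⁻ {S = S} e
  ... | refl , e′ = trans (cong suc (scan-length S st r e′)) (sym (+-suc (length r) (closes S)))

  scan-pops⊎stays : ∀ N u a s s₂ → scan N (u ++ a ∷ s) ≡ just s₂ →
    (∃ λ t → scan N u ≡ just t × s₂ ≡ t ++ a ∷ s) ⊎
    (∃ λ B → ∃ λ N′ → N ≡ B ++ cl a ∷ N′ × scan B u ≡ just [] × scan N′ s ≡ just s₂)
  scan-pops⊎stays []         u a s s₂ refl = inj₁ (u , refl , refl)
  scan-pops⊎stays (op b ∷ N) u a s s₂ e with scan-pops⊎stays N (b ∷ u) a s s₂ e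
  ... | inj₁ r                             = inj₁ r
  ... | inj₂ (B , N′ , refl , e₁ , e₂)     = inj₂ (op b ∷ B , N′ , refl , e₁ , e₂)
  scan-pops⊎stays (cl b ∷ N) [] a s s₂ e with scan-cl⁻ {S = N} e
  ... | refl , e′ = inj₂ ([] , N , refl , refl , e′)
  scan-pops⊎stays (cl b ∷ N) (c ∷ u) a s s₂ e with scan-cl⁻ {S = N} e
  ... | refl , e′ with scan-pops⊎stays N u a s s₂ e′
  ... | inj₁ (t , e₁ , e₂)             = inj₁ (t , trans (scan-cl⁺ {S = N}) e₁ , e₂)
  ... | inj₂ (B , N′ , refl , e₁ , e₂) = inj₂ (cl b ∷ B , N′ , refl , trans (scan-cl⁺ {S = B}) e₁ , e₂)

  scan-pushed⊎kept : ∀ Q u a st → scan Q u ≡ just (a ∷ st) →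
    (∃ λ Q₀ → ∃ λ C → Q ≡ Q₀ ++ op a ∷ C × scan C [] ≡ just [] × scan Q₀ u ≡ just st) ⊎
    (∃ λ t → u ≡ t ++ a ∷ st × scan Q t ≡ just [])
  scan-pushed⊎kept []         u a st refl = inj₂ ([] , refl , refl)
  scan-pushed⊎kept (op b ∷ Q) u a st e with scan-pushed⊎kept Q (b ∷ u) a st e
  ... | inj₁ (Q₀ , C , refl , e₁ , e₂) = inj₁ (op b ∷ Q₀ , C , refl , e₁ , e₂)
  ... | inj₂ ([] , refl , e₁)          = inj₁ ([] , Q , refl , e₁ , refl)
  ... | inj₂ (c ∷ t , refl , e₁)       = inj₂ (t , refl , e₁)
  scan-pushed⊎kept (cl b ∷ Q) (c ∷ u) a st e with scan-cl⁻ {S = Q} e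
  ... | refl , e′ with scan-pushed⊎kept Q u a st e′
  ... | inj₁ (Q₀ , C , refl , e₁ , e₂) = inj₁ (cl b ∷ Q₀ , C , refl , e₁ , trans (scan-cl⁺ {S = Q₀}) e₂)
  ... | inj₂ (t , refl , e₁)           = inj₂ (b ∷ t , refl , trans (scan-cl⁺ {S = Q}) e₁)

  scan⇒Bal : ∀ {S} → scan S [] ≡ just [] → Bal S
  scan⇒Bal {S} = go (length S) S ≤-refl
    where
    go : ∀ n S → length S ≤ n → scan S [] ≡ just [] → Bal S
    go n       []         _ _ = nil
    go (suc n) (op a ∷ S) (s≤s ∣S∣≤n) e with scan-pops⊎stays S [] a [] [] e
    ... | inj₁ (t , _ , eq) = ⊥-elim ([]≢++∷ t a [] eq)
    ... | inj₂ (B , N , refl , e₁ , e₂) =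
      node a (go n B (≤-trans (m≤m+n (length B) _) ∣BN∣≤n) e₁)
             (go n N (≤-trans (n≤1+n _) (≤-trans (m≤n+m (suc (length N)) (length B)) ∣BN∣≤n)) e₂)
      where
      ∣BN∣≤n : length B + suc (length N) ≤ n
      ∣BN∣≤n = ≤-trans (≤-reflexive (sym (length-++ B))) ∣S∣≤n

  Bal-++ : ∀ {X Y} → Bal X → Bal Y → Bal (X ++ Y)
  Bal-++ {X} {Y} bx by = scan⇒Bal (scan-++⁺ X Y [] (Bal⇒scan bx []) (Bal⇒scan by []))

  scan-emptying-length : ∀ Y s s′ → scan Y s ≡ just [] → scan Y s′ ≡ just [] → length s′ ≡ length s
  scan-emptying-length Y s s′ e e′ =
    +-cancelʳ-≡ _ _ _ (trans (scan-length Y s′ [] e′) (sym (scan-length Y s [] e)))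

  -- An opening parenthesis of X that is closed inside N in X·N·Y but inside Y in X·M·Y.
  record Crossing (X N Y : List (Paren A)) : Set where
    constructor crossing
    field
      e             : A
      X₀ C B N′ B′ Y′ : List (Paren A)
      X≡            : X ≡ X₀ ++ op e ∷ C
      N≡            : N ≡ B ++ cl e ∷ N′
      Y≡            : Y ≡ B′ ++ cl e ∷ Y′
      bal-C         : Bal C
      bal-B         : Bal B
      bal-B′        : Bal B′

  hole-Bal⊎Crossing : ∀ X M N Y → Bal M → Bal (X ++ M ++ Y) → Bal (X ++ N ++ Y) → Bal N ⊎ Crossing X N Y
  hole-Bal⊎Crossing X M N Y bM bXMY bXNY
    with scan-++⁻ X (M ++ Y) [] [] (Bal⇒scan bXMY []) | scan-++⁻ X (N ++ Y) [] [] (Bal⇒scan bXNY [])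
  ... | s , sX , sMY | s′ , sX′ , sNY with trans (sym sX′) sX
  ... | refl with scan-++⁻ M Y s [] sMY | scan-++⁻ N Y s [] sNY
  ... | s₁ , sM , sY | s₂ , sN , sY′ with trans (sym (Bal⇒scan bM s)) sM
  ... | refl = cases s sX sY sN sY′
    where
    cases : ∀ s → scan X [] ≡ just s → scan Y s ≡ just [] → ∀ {s₂} → scan N s ≡ just s₂ → scan Y s₂ ≡ just [] →
            Bal N ⊎ Crossing X N Y
    cases [] _ sY {s₂} sN sY′ =
      inj₁ (scan⇒Bal (trans sN (cong just (length≡0⇒[] s₂ (scan-emptying-length Y [] s₂ sY sY′)))))
    cases (e ∷ s) sX sY {s₂} sN sY′ with scan-pops⊎stays N [] e s s₂ sN
    ... | inj₁ (t , sN₀ , refl) =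
      inj₁ (scan⇒Bal (trans sN₀ (cong just (length≡0⇒[] t
        (+-cancelʳ-≡ _ _ _ (trans (sym (length-++ t)) (scan-emptying-length Y (e ∷ s) (t ++ e ∷ s) sY sY′)))))))
    ... | inj₂ (B , N′ , eqN , sB , _) with scan-pushed⊎kept X [] e s sX | scan-pops⊎stays Y [] e s [] sY
    ...   | inj₂ (t , eq , _) | _ = ⊥-elim ([]≢++∷ t e s eq)
    ...   | _ | inj₁ (t , _ , eq) = ⊥-elim ([]≢++∷ t e s eq)
    ...   | inj₁ (X₀ , C , eqX , sC , _) | inj₂ (B′ , Y′ , eqY , sB′ , _) =
      inj₂ (crossing e X₀ C B N′ B′ Y′ eqX eqN eqY (scan⇒Bal sC) (scan⇒Bal sB) (scan⇒Bal sB′))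

module Mates {A : Set} (_≟_ : DecidableEquality A) where

  open Stack _≟_

  Matched-++ : ∀ {S : List (Paren A)} L (a : A) C R → S ≡ L ++ op a ∷ (C ++ cl a ∷ R) → Bal C →
               Matched S (length L) (length L + suc (length C))
  Matched-++ {S} L a C R refl bc =
      m<m+n (length L) (s≤s z≤n)
    , subst (length L + suc (length C) <_) (sym ∣S∣)
        (+-monoʳ-< (length L) (s≤s (≤-trans (s≤s (m≤m+n (length C) (length R)))
                                            (≤-reflexive (sym (+-suc (length C) (length R)))))))
    , a , at-++-length L (op a) (C ++ cl a ∷ R)
    , subst (λ z → at S z ≡ just (cl a)) (length-++ L)
        (subst (λ T → at T (length (L ++ op a ∷ C)) ≡ just (cl a)) (++-assoc L (op a ∷ C) (cl a ∷ R))
          (at-++-length (L ++ op a ∷ C) (cl a) R))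
    , subst Bal (sym inner) bc
    where
    ∣S∣ : length S ≡ length L + suc (length C + suc (length R))
    ∣S∣ = trans (length-++ L) (cong (λ z → length L + suc z) (length-++ C))
    inner : frag S (suc (length L)) (length L + suc (length C)) ≡ C
    inner = subst₂ (λ T z → frag T z (length L + suc (length C)) ≡ C)
      (++-assoc L (op a ∷ []) (C ++ cl a ∷ R))
      (trans (length-++ L) (+-comm (length L) 1))
      (subst (λ z → frag ((L ++ op a ∷ []) ++ C ++ cl a ∷ R) (length (L ++ op a ∷ [])) z ≡ C)
        (trans (cong (_+ length C) (trans (length-++ L) (+-comm (length L) 1)))
               (sym (+-suc (length L) (length C))))
        (frag-of-++ (L ++ op a ∷ []) C (cl a ∷ R)))

  open-has-mate : ∀ {S} → Bal S → ∀ p a → at S p ≡ just (op a) → ∃ λ q → Matched S p q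
  open-has-mate {S} bS p a e with at-just⇒split S p e
  ... | L , R , refl , refl with scan-++⁻ L (op a ∷ R) [] [] (Bal⇒scan bS [])
  ... | m , _ , e₂ with scan-pops⊎stays R [] a m [] e₂
  ... | inj₁ (t , _ , eq)          = ⊥-elim ([]≢++∷ t a m eq)
  ... | inj₂ (B , N , refl , e₃ , _) = _ , Matched-++ L a B N refl (scan⇒Bal e₃)

  close-has-mate : ∀ {S} → Bal S → ∀ p a → at S p ≡ just (cl a) → ∃ λ q → Matched S q p
  close-has-mate {S} bS p a e with at-just⇒split S p e
  ... | L , R , refl , refl with scan-++⁻ L (cl a ∷ R) [] [] (Bal⇒scan bS [])
  ... | b ∷ m , e₁ , e₂ with scan-cl⁻ {S = R} e₂
  ... | refl , _ with scan-pushed⊎kept L [] a m e₁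
  ... | inj₂ (t , eq , _) = ⊥-elim ([]≢++∷ t a m eq)
  ... | inj₁ (Q₀ , C , refl , e₃ , _) = length Q₀ ,
    subst (Matched ((Q₀ ++ op a ∷ C) ++ cl a ∷ R) (length Q₀)) (sym (length-++ Q₀))
      (Matched-++ Q₀ a C R (++-assoc Q₀ (op a ∷ C) (cl a ∷ R)) (scan⇒Bal e₃))

Δx Δy : Step → ℕ
Δx del = 1
Δx ins = 0
Δx ali = 1
Δy del = 0
Δy ins = 1
Δy ali = 1

Δx≤1 : ∀ s → Δx s ≤ 1
Δx≤1 del = s≤s z≤n
Δx≤1 ins = z≤n
Δx≤1 ali = s≤s z≤n

-- Past the end of the path stepAt returns ali and the coordinates 0; only n < length P
-- (resp. n ≤ length P) is ever used.
stepAt : List Step → ℕ → Step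
stepAt []      _       = ali
stepAt (s ∷ P) zero    = s
stepAt (s ∷ P) (suc n) = stepAt P n

xAt yAt : List Step → ℕ → ℕ
xAt P       zero    = 0
xAt []      (suc n) = 0
xAt (s ∷ P) (suc n) = Δx s + xAt P n
yAt P       zero    = 0
yAt []      (suc n) = 0
yAt (s ∷ P) (suc n) = Δy s + yAt P n

xAt-suc : ∀ P n → n < length P → xAt P (suc n) ≡ xAt P n + Δx (stepAt P n)
xAt-suc (s ∷ P) zero    _        = +-identityʳ (Δx s)
xAt-suc (s ∷ P) (suc n) (s≤s lt) = trans (cong (Δx s +_) (xAt-suc P n lt)) (sym (+-assoc (Δx s) _ _))

yAt-suc : ∀ P n → n < length P → yAt P (suc n) ≡ yAt P n + Δy (stepAt P n)
yAt-suc (s ∷ P) zero    _        = +-identityʳ (Δy s)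
yAt-suc (s ∷ P) (suc n) (s≤s lt) = trans (cong (Δy s +_) (yAt-suc P n lt)) (sym (+-assoc (Δy s) _ _))

private
  origin : ∀ x₀ y₀ (s : Step) → (x₀ , y₀ , s) ≡ (x₀ + 0 , y₀ + 0 , s)
  origin x₀ y₀ s = cong₂ _,_ (sym (+-identityʳ x₀)) (cong₂ _,_ (sym (+-identityʳ y₀)) refl)

∈-tagged⁻ : ∀ x₀ y₀ P {e} → e ∈ tagged x₀ y₀ P →
            ∃ λ n → n < length P × e ≡ (x₀ + xAt P n , y₀ + yAt P n , stepAt P n)
∈-tagged⁻ x₀ y₀ (del ∷ P) (here refl) = 0 , s≤s z≤n , origin x₀ y₀ del
∈-tagged⁻ x₀ y₀ (ins ∷ P) (here refl) = 0 , s≤s z≤n , origin x₀ y₀ ins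
∈-tagged⁻ x₀ y₀ (ali ∷ P) (here refl) = 0 , s≤s z≤n , origin x₀ y₀ ali
∈-tagged⁻ x₀ y₀ (del ∷ P) (there m) with ∈-tagged⁻ (suc x₀) y₀ P m
... | n , lt , refl = suc n , s≤s lt , cong₂ _,_ (sym (+-suc x₀ _)) refl
∈-tagged⁻ x₀ y₀ (ins ∷ P) (there m) with ∈-tagged⁻ x₀ (suc y₀) P m
... | n , lt , refl = suc n , s≤s lt , cong₂ _,_ refl (cong₂ _,_ (sym (+-suc y₀ _)) refl)
∈-tagged⁻ x₀ y₀ (ali ∷ P) (there m) with ∈-tagged⁻ (suc x₀) (suc y₀) P m
... | n , lt , refl = suc n , s≤s lt , cong₂ _,_ (sym (+-suc x₀ _)) (cong₂ _,_ (sym (+-suc y₀ _)) refl)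

∈-tagged⁺ : ∀ x₀ y₀ P n → n < length P → (x₀ + xAt P n , y₀ + yAt P n , stepAt P n) ∈ tagged x₀ y₀ P
∈-tagged⁺ x₀ y₀ (del ∷ P) zero _ rewrite +-identityʳ x₀ | +-identityʳ y₀ = here refl
∈-tagged⁺ x₀ y₀ (ins ∷ P) zero _ rewrite +-identityʳ x₀ | +-identityʳ y₀ = here refl
∈-tagged⁺ x₀ y₀ (ali ∷ P) zero _ rewrite +-identityʳ x₀ | +-identityʳ y₀ = here refl
∈-tagged⁺ x₀ y₀ (del ∷ P) (suc n) (s≤s lt) rewrite +-suc x₀ (xAt P n) =
  there (∈-tagged⁺ (suc x₀) y₀ P n lt)
∈-tagged⁺ x₀ y₀ (ins ∷ P) (suc n) (s≤s lt) rewrite +-suc y₀ (yAt P n) =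
  there (∈-tagged⁺ x₀ (suc y₀) P n lt)
∈-tagged⁺ x₀ y₀ (ali ∷ P) (suc n) (s≤s lt) rewrite +-suc x₀ (xAt P n) | +-suc y₀ (yAt P n) =
  there (∈-tagged⁺ (suc x₀) (suc y₀) P n lt)

∈-verts⁻ : ∀ x₀ y₀ P {v} → v ∈ verts x₀ y₀ P → ∃ λ n → n ≤ length P × v ≡ (x₀ + xAt P n , y₀ + yAt P n)
∈-verts⁻ x₀ y₀ []      (here refl) = 0 , z≤n , cong₂ _,_ (sym (+-identityʳ x₀)) (sym (+-identityʳ y₀))
∈-verts⁻ x₀ y₀ (del ∷ P) (here refl) = 0 , z≤n , cong₂ _,_ (sym (+-identityʳ x₀)) (sym (+-identityʳ y₀))
∈-verts⁻ x₀ y₀ (ins ∷ P) (here refl) = 0 , z≤n , cong₂ _,_ (sym (+-identityʳ x₀)) (sym (+-identityʳ y₀))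
∈-verts⁻ x₀ y₀ (ali ∷ P) (here refl) = 0 , z≤n , cong₂ _,_ (sym (+-identityʳ x₀)) (sym (+-identityʳ y₀))
∈-verts⁻ x₀ y₀ (del ∷ P) (there m) with ∈-verts⁻ (suc x₀) y₀ P m
... | n , le , refl = suc n , s≤s le , cong₂ _,_ (sym (+-suc x₀ _)) refl
∈-verts⁻ x₀ y₀ (ins ∷ P) (there m) with ∈-verts⁻ x₀ (suc y₀) P m
... | n , le , refl = suc n , s≤s le , cong₂ _,_ refl (sym (+-suc y₀ _))
∈-verts⁻ x₀ y₀ (ali ∷ P) (there m) with ∈-verts⁻ (suc x₀) (suc y₀) P m
... | n , le , refl = suc n , s≤s le , cong₂ _,_ (sym (+-suc x₀ _)) (sym (+-suc y₀ _))

endpoint≡At-length : ∀ x₀ y₀ P → endpoint x₀ y₀ P ≡ (x₀ + xAt P (length P) , y₀ + yAt P (length P))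
endpoint≡At-length x₀ y₀ []        = cong₂ _,_ (sym (+-identityʳ x₀)) (sym (+-identityʳ y₀))
endpoint≡At-length x₀ y₀ (del ∷ P) = trans (endpoint≡At-length (suc x₀) y₀ P) (cong₂ _,_ (sym (+-suc x₀ _)) refl)
endpoint≡At-length x₀ y₀ (ins ∷ P) = trans (endpoint≡At-length x₀ (suc y₀) P) (cong₂ _,_ refl (sym (+-suc y₀ _)))
endpoint≡At-length x₀ y₀ (ali ∷ P) =
  trans (endpoint≡At-length (suc x₀) (suc y₀) P) (cong₂ _,_ (sym (+-suc x₀ _)) (sym (+-suc y₀ _)))

sumBelow : ℕ → (ℕ → ℕ) → ℕ
sumBelow zero    f = 0
sumBelow (suc n) f = f 0 + sumBelow n (λ m → f (suc m))

sumBelow-cong : ∀ n (f g : ℕ → ℕ) → (∀ m → m < n → f m ≡ g m) → sumBelow n f ≡ sumBelow n g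
sumBelow-cong zero    f g h = refl
sumBelow-cong (suc n) f g h = cong₂ _+_ (h 0 (s≤s z≤n)) (sumBelow-cong n _ _ (λ m lt → h (suc m) (s≤s lt)))

sumBelow-suc : ∀ n (f : ℕ → ℕ) → sumBelow (suc n) f ≡ sumBelow n f + f n
sumBelow-suc zero    f = +-comm (f 0) 0
sumBelow-suc (suc n) f =
  trans (cong (f 0 +_) (sumBelow-suc n (λ m → f (suc m)))) (sym (+-assoc (f 0) _ _))

cost2≡sumBelow : ∀ {A} (_≟_ : DecidableEquality A) F G x₀ y₀ P →
  cost2 _≟_ F G (tagged x₀ y₀ P) ≡
  sumBelow (length P) (λ n → stepCost2 _≟_ (stepAt P n) (at F (x₀ + xAt P n)) (at G (y₀ + yAt P n)))
cost2≡sumBelow _≟_ F G x₀ y₀ [] = refl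
cost2≡sumBelow _≟_ F G x₀ y₀ (del ∷ P) = cong suc (trans (cost2≡sumBelow _≟_ F G (suc x₀) y₀ P)
  (sumBelow-cong (length P) _ _ λ m _ →
    cong (λ z → stepCost2 _≟_ (stepAt P m) (at F z) (at G (y₀ + yAt P m))) (sym (+-suc x₀ _))))
cost2≡sumBelow _≟_ F G x₀ y₀ (ins ∷ P) = cong suc (trans (cost2≡sumBelow _≟_ F G x₀ (suc y₀) P)
  (sumBelow-cong (length P) _ _ λ m _ →
    cong (λ z → stepCost2 _≟_ (stepAt P m) (at F (x₀ + xAt P m)) (at G z)) (sym (+-suc y₀ _))))
cost2≡sumBelow _≟_ F G x₀ y₀ (ali ∷ P) =
  cong₂ _+_ (cong₂ (λ z w → stepCost2 _≟_ ali (at F z) (at G w)) (sym (+-identityʳ x₀)) (sym (+-identityʳ y₀)))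
    (trans (cost2≡sumBelow _≟_ F G (suc x₀) (suc y₀) P)
      (sumBelow-cong (length P) _ _ λ m _ →
        cong₂ (λ z w → stepCost2 _≟_ (stepAt P m) (at F z) (at G w)) (sym (+-suc x₀ _)) (sym (+-suc y₀ _))))

module Counter (L : ℕ) (f d : ℕ → ℕ) (f-suc : ∀ n → n < L → f (suc n) ≡ f n + d n) (f-zero : f 0 ≡ 0) where

  mono : ∀ m n → m ≤ n → n ≤ L → f m ≤ f n
  mono m zero    z≤n _ = ≤-refl
  mono m (suc n) m≤n n<L with m ≟ℕ suc n
  ... | yes refl = ≤-refl
  ... | no m≢n   = ≤-trans (mono m n (≤-pred (≤∧≢⇒< m≤n m≢n)) (≤-trans (n≤1+n n) n<L))
                           (≤-trans (m≤m+n (f n) (d n)) (≤-reflexive (sym (f-suc n n<L))))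

  strict : ∀ m n → m < n → n ≤ L → d m ≡ 1 → f m < f n
  strict m n m<n n≤L dm≡1 =
    ≤-trans (≤-reflexive (trans (+-comm 1 (f m)) (trans (cong (f m +_) (sym dm≡1)) (sym (f-suc m (≤-trans m<n n≤L))))))
            (mono (suc m) n m<n n≤L)

  injective : ∀ m n → m < L → n < L → f m ≡ f n → d m ≡ 1 → d n ≡ 1 → m ≡ n
  injective m n m<L n<L e dm dn with <-cmp m n
  ... | tri≈ _ m≡n _ = m≡n
  ... | tri< m<n _ _ = ⊥-elim (<-irrefl e (strict m n m<n (<⇒≤ n<L) dm))
  ... | tri> _ _ n<m = ⊥-elim (<-irrefl (sym e) (strict n m n<m (<⇒≤ m<L) dn))

  hits : (∀ n → d n ≤ 1) → ∀ N → N ≤ L → ∀ x → x < f N → ∃ λ n → n < N × f n ≡ x × d n ≡ 1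
  hits d≤1 zero    _   x lt rewrite f-zero = ⊥-elim (n≮0 lt)
  hits d≤1 (suc N) N<L x lt with x <? f N
  ... | yes lt′ with hits d≤1 N (≤-trans (n≤1+n N) N<L) x lt′
  ...   | n , n<N , e , dn = n , ≤-trans n<N (n≤1+n N) , e , dn
  hits d≤1 (suc N) N<L x lt | no x≮fN with d N in dN | d≤1 N | f-suc N N<L
  ... | zero        | _        | e = ⊥-elim (x≮fN (subst (x <_) (trans e (+-identityʳ (f N))) lt))
  ... | suc zero    | _        | e =
    N , ≤-refl , ≤-antisym (≮⇒≥ x≮fN) (≤-pred (subst (x <_) (trans e (+-comm (f N) 1)) lt)) , dN
  ... | suc (suc _) | s≤s () | _

module Geometry (P : List Step) where

  L : ℕ
  L = length P

  X Y : ℕ → ℕ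
  X = xAt P
  Y = yAt P

  S : ℕ → Step
  S = stepAt P

  module X-counter = Counter L X (λ n → Δx (S n)) (xAt-suc P) refl
  module Y-counter = Counter L Y (λ n → Δy (S n)) (yAt-suc P) refl

  AlignedAt : ℕ → ℕ → ℕ → Set
  AlignedAt n x y = n < L × S n ≡ ali × X n ≡ x × Y n ≡ y

  aligned⇒AlignedAt : ∀ {x y} → Aligned P x y → ∃ λ n → AlignedAt n x y
  aligned⇒AlignedAt m with ∈-tagged⁻ 0 0 P m
  ... | n , lt , e with S n in es | e
  ... | ali | refl = n , lt , es , refl , refl

  AlignedAt⇒aligned : ∀ {n x y} → AlignedAt n x y → Aligned P x y
  AlignedAt⇒aligned {n} (lt , e , refl , refl) = subst (λ s → (X n , Y n , s) ∈ tagged 0 0 P) e (∈-tagged⁺ 0 0 P n lt)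

  ali⇒Δx≡1 : ∀ {n} → S n ≡ ali → Δx (S n) ≡ 1
  ali⇒Δx≡1 e rewrite e = refl

  ali⇒Δy≡1 : ∀ {n} → S n ≡ ali → Δy (S n) ≡ 1
  ali⇒Δy≡1 e rewrite e = refl

  aligned-functional : ∀ {x y y′} → Aligned P x y → Aligned P x y′ → y ≡ y′
  aligned-functional a₁ a₂ with aligned⇒AlignedAt a₁ | aligned⇒AlignedAt a₂
  ... | n , n<L , sn , refl , refl | m , m<L , sm , e , refl
    with X-counter.injective n m n<L m<L (sym e) (ali⇒Δx≡1 sn) (ali⇒Δx≡1 sm)
  ... | refl = refl

  aligned-monotone : ∀ {x y x′ y′} → Aligned P x y → Aligned P x′ y′ → x < x′ → y < y′
  aligned-monotone a₁ a₂ x<x′ with aligned⇒AlignedAt a₁ | aligned⇒AlignedAt a₂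
  ... | n , n<L , sn , refl , refl | m , m<L , sm , refl , refl with <-cmp n m
  ... | tri< n<m _ _ = Y-counter.strict n m n<m (<⇒≤ m<L) (ali⇒Δy≡1 sn)
  ... | tri≈ _ refl _ = ⊥-elim (<-irrefl refl x<x′)
  ... | tri> _ _ m<n = ⊥-elim (<-asym x<x′ (X-counter.strict m n m<n (<⇒≤ n<L) (ali⇒Δx≡1 sm)))

_≟Piece_ : DecidableEquality Piece
sub i j ≟Piece sub a b with i ≟ℕ a | j ≟ℕ b
... | yes refl | yes refl = yes refl
... | no i≢a   | _        = no λ { refl → i≢a refl }
... | _        | no j≢b   = no λ { refl → j≢b refl }
ctx i i′ j′ j ≟Piece ctx a a′ b′ b with i ≟ℕ a | i′ ≟ℕ a′ | j′ ≟ℕ b′ | j ≟ℕ b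
... | yes refl | yes refl | yes refl | yes refl = yes refl
... | no ≢     | _        | _        | _        = no λ { refl → ≢ refl }
... | _        | no ≢     | _        | _        = no λ { refl → ≢ refl }
... | _        | _        | no ≢     | _        = no λ { refl → ≢ refl }
... | _        | _        | _        | no ≢     = no λ { refl → ≢ refl }
sub _ _ ≟Piece ctx _ _ _ _ = no λ ()
ctx _ _ _ _ ≟Piece sub _ _ = no λ ()

InPiece? : ∀ y g → Dec (InPiece y g)
InPiece? y (sub a b)       = (a ≤? y) ×-dec (y <? b)
InPiece? y (ctx a a′ b′ b) = ((a ≤? y) ×-dec (y <? a′)) ⊎-dec ((b′ ≤? y) ×-dec (y <? b))

-- The positions of a piece form one or two intervals (its arms); a subforest uses only
-- the arm `false`, its arm `true` being empty.
arm : Piece → Bool → ℕ × ℕ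
arm (sub i j)       false = i , j
arm (sub i j)       true  = 0 , 0
arm (ctx i i′ j′ j) false = i , i′
arm (ctx i i′ j′ j) true  = j′ , j

InArm : Piece → Bool → ℕ → Set
InArm d b x = proj₁ (arm d b) ≤ x × x < proj₂ (arm d b)

WellFormed : {A : Set} → List (Paren A) → Piece → Set
WellFormed F (sub i j)       = i < j × BalFrag F i j
WellFormed F (ctx i i′ j′ j) = IsContext F i i′ j′ j

module _ {A : Set} (F : List (Paren A)) where

  decomp-wellFormed : ∀ {i j D} → PieceDecomp F i j D → ∀ {d} → d ∈ D → WellFormed F d
  decomp-wellFormed (whole lt bf) (here refl) = lt , bf
  decomp-wellFormed (split {DL = DL} _ _ _ _ pl pr) m with ∈-++⁻ DL m
  ... | inj₁ m′ = decomp-wellFormed pl m′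
  ... | inj₂ m′ = decomp-wellFormed pr m′
  decomp-wellFormed (wrap c _)  (here refl) = c
  decomp-wellFormed (wrap c pd) (there m)   = decomp-wellFormed pd m

  decomp-bounds : ∀ {i j D} → PieceDecomp F i j D → ∀ {d b x} → d ∈ D → InArm d b x → i ≤ x × x < j
  decomp-bounds (whole lt bf) {b = false} (here refl) h = h
  decomp-bounds (split {DL = DL} i<m m<j _ _ pl pr) m h with ∈-++⁻ DL m
  ... | inj₁ m′ = let (lo , hi) = decomp-bounds pl m′ h in lo , <-trans hi m<j
  ... | inj₂ m′ = let (lo , hi) = decomp-bounds pr m′ h in ≤-trans (<⇒≤ i<m) lo , hi
  decomp-bounds (wrap (i<i′ , i′≤j′ , j′<j , _) _) {b = false} (here refl) (lo , hi) =
    lo , <-trans (<-≤-trans hi i′≤j′) j′<j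
  decomp-bounds (wrap (i<i′ , i′≤j′ , j′<j , _) _) {b = true}  (here refl) (lo , hi) =
    ≤-trans (<⇒≤ (<-≤-trans i<i′ i′≤j′)) lo , hi
  decomp-bounds (wrap (i<i′ , _ , j′<j , _) pd) (there m) h =
    let (lo , hi) = decomp-bounds pd m h in ≤-trans (<⇒≤ i<i′) lo , <-trans hi j′<j

  decomp-covers : ∀ {i j D} → PieceDecomp F i j D → ∀ x → i ≤ x → x < j →
                  ∃ λ d → ∃ λ b → d ∈ D × InArm d b x
  decomp-covers (empty _) x i≤x x<i = ⊥-elim (<-irrefl refl (≤-<-trans i≤x x<i))
  decomp-covers (whole lt bf) x lo hi = _ , false , here refl , lo , hi
  decomp-covers (split {m = m} {DL = DL} _ _ _ _ pl pr) x lo hi with x <? m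
  ... | yes x<m = let (d , b , d∈ , h) = decomp-covers pl x lo x<m in d , b , ∈-++⁺ˡ d∈ , h
  ... | no x≮m  = let (d , b , d∈ , h) = decomp-covers pr x (≮⇒≥ x≮m) hi in d , b , ∈-++⁺ʳ DL d∈ , h
  decomp-covers (wrap {i' = i′} {j' = j′} c pd) x lo hi with x <? i′ | j′ ≤? x
  ... | yes x<i′ | _       = _ , false , here refl , lo , x<i′
  ... | no _     | yes j′≤x = _ , true , here refl , j′≤x , hi
  ... | no x≮i′  | no j′≰x  =
    let (d , b , d∈ , h) = decomp-covers pd x (≮⇒≥ x≮i′) (≰⇒> j′≰x) in d , b , there d∈ , h

  decomp-disjoint : ∀ {i j D} → PieceDecomp F i j D → ∀ {d d′ b b′ x} → d ∈ D → d′ ∈ D →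
                    InArm d b x → InArm d′ b′ x → d ≡ d′ × b ≡ b′
  decomp-disjoint (whole lt bf) {b = false} {b′ = false} (here refl) (here refl) _ _ = refl , refl
  decomp-disjoint (split {DL = DL} _ _ _ _ pl pr) m m′ h h′ with ∈-++⁻ DL m | ∈-++⁻ DL m′
  ... | inj₁ l | inj₁ l′ = decomp-disjoint pl l l′ h h′
  ... | inj₂ r | inj₂ r′ = decomp-disjoint pr r r′ h h′
  ... | inj₁ l | inj₂ r  = ⊥-elim (<-irrefl refl (<-≤-trans (proj₂ (decomp-bounds pl l h)) (proj₁ (decomp-bounds pr r h′))))
  ... | inj₂ r | inj₁ l  = ⊥-elim (<-irrefl refl (<-≤-trans (proj₂ (decomp-bounds pl l h′)) (proj₁ (decomp-bounds pr r h))))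
  decomp-disjoint (wrap c pd) {b = false} {b′ = false} (here refl) (here refl) _ _ = refl , refl
  decomp-disjoint (wrap c pd) {b = true}  {b′ = true}  (here refl) (here refl) _ _ = refl , refl
  decomp-disjoint (wrap (_ , i′≤j′ , _) pd) {b = false} {b′ = true} (here refl) (here refl) (_ , x<i′) (j′≤x , _) =
    ⊥-elim (<-irrefl refl (<-≤-trans x<i′ (≤-trans i′≤j′ j′≤x)))
  decomp-disjoint (wrap (_ , i′≤j′ , _) pd) {b = true} {b′ = false} (here refl) (here refl) (j′≤x , _) (_ , x<i′) =
    ⊥-elim (<-irrefl refl (<-≤-trans x<i′ (≤-trans i′≤j′ j′≤x)))
  decomp-disjoint (wrap c pd) {b = false} (here refl) (there m′) (_ , x<i′) h′ =
    ⊥-elim (<-irrefl refl (<-≤-trans x<i′ (proj₁ (decomp-bounds pd m′ h′))))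
  decomp-disjoint (wrap c pd) {b = true}  (here refl) (there m′) (j′≤x , _) h′ =
    ⊥-elim (<-irrefl refl (<-≤-trans (proj₂ (decomp-bounds pd m′ h′)) j′≤x))
  decomp-disjoint (wrap c pd) {b′ = false} (there m) (here refl) h (_ , x<i′) =
    ⊥-elim (<-irrefl refl (<-≤-trans x<i′ (proj₁ (decomp-bounds pd m h))))
  decomp-disjoint (wrap c pd) {b′ = true}  (there m) (here refl) h (j′≤x , _) =
    ⊥-elim (<-irrefl refl (<-≤-trans (proj₂ (decomp-bounds pd m h)) j′≤x))
  decomp-disjoint (wrap c pd) (there m) (there m′) h h′ = decomp-disjoint pd m m′ h h′

zeroAt : (ℕ → ℕ) → ℕ → ℕ → ℕ
zeroAt c x m with m ≟ℕ x
... | yes _ = 0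
... | no  _ = c m

zeroAt-≡ : ∀ c x → zeroAt c x x ≡ 0
zeroAt-≡ c x with x ≟ℕ x
... | yes _  = refl
... | no x≢x = ⊥-elim (x≢x refl)

zeroAt-≢ : ∀ c x m → m ≢ x → zeroAt c x m ≡ c m
zeroAt-≢ c x m m≢x with m ≟ℕ x
... | yes m≡x = ⊥-elim (m≢x m≡x)
... | no  _   = refl

sumBelow-zeroAt : ∀ N c x → x < N → sumBelow N c ≡ c x + sumBelow N (zeroAt c x)
sumBelow-zeroAt (suc N) c zero _ =
  cong (c 0 +_) (trans (sumBelow-cong N _ _ (λ m _ → sym (zeroAt-≢ c 0 (suc m) (λ ()))))
                       (cong (_+ sumBelow N (λ m → zeroAt c 0 (suc m))) (sym (zeroAt-≡ c 0))))
sumBelow-zeroAt (suc N) c (suc x) (s≤s x<N) = begin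
  c 0 + sumBelow N c⁺                                                 ≡⟨ cong (c 0 +_) (sumBelow-zeroAt N c⁺ x x<N) ⟩
  c 0 + (c (suc x) + sumBelow N (zeroAt c⁺ x))                        ≡⟨ swap (c 0) (c (suc x)) _ ⟩
  c (suc x) + (c 0 + sumBelow N (zeroAt c⁺ x))                        ≡⟨ cong₂ (λ u v → c (suc x) + (u + v))
                                                                           (sym (zeroAt-≢ c (suc x) 0 (λ ())))
                                                                           (sumBelow-cong N _ _ (λ m _ → shift m)) ⟩
  c (suc x) + sumBelow (suc N) (zeroAt c (suc x))                     ∎
  where
  open ≡-Reasoning
  c⁺ = λ m → c (suc m)
  swap : ∀ a b d → a + (b + d) ≡ b + (a + d)
  swap = solve-∀
  shift : ∀ m → zeroAt c⁺ x m ≡ zeroAt c (suc x) (suc m)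
  shift m with m ≟ℕ x | suc m ≟ℕ suc x
  ... | yes _   | yes _     = refl
  ... | no  _   | no  _     = refl
  ... | yes m≡x | no  m≢x   = ⊥-elim (m≢x (cong suc m≡x))
  ... | no  m≢x | yes m≡x   = ⊥-elim (m≢x (suc-injective m≡x))

Unique-length≤sumBelow : ∀ N (c : ℕ → ℕ) (xs : List ℕ) → Unique xs →
                         (∀ {x} → x ∈ xs → x < N × c x ≡ 1) → length xs ≤ sumBelow N c
Unique-length≤sumBelow N c []       _          _ = z≤n
Unique-length≤sumBelow N c (x ∷ xs) (x∉ ∷ uxs) h =
  let (x<N , cx≡1) = h (here refl) in
  subst (suc (length xs) ≤_) (sym (trans (sumBelow-zeroAt N c x x<N) (cong (_+ sumBelow N (zeroAt c x)) cx≡1)))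
    (s≤s (Unique-length≤sumBelow N (zeroAt c x) xs uxs λ {y} y∈ →
      proj₁ (h (there y∈)) , trans (zeroAt-≢ c x y (λ y≡x → All.lookup x∉ y∈ (sym y≡x))) (proj₂ (h (there y∈)))))

module Pigeonhole {X : Set} (V : ℕ → Set) (Q : X → ℕ → Set)
                  (Q-injective : ∀ {x x′ k} → Q x k → Q x′ k → x ≡ x′) where

  Coded : List X → Set
  Coded xs = ∀ {x} → x ∈ xs → ∃ λ k → V k × Q x k

  private
    codes : (xs : List X) → Coded xs → List ℕ
    codes []       h = []
    codes (x ∷ xs) h = proj₁ (h (here refl)) ∷ codes xs (λ m → h (there m))

    length-codes : ∀ xs (h : Coded xs) → length (codes xs h) ≡ length xs
    length-codes []       h = refl
    length-codes (x ∷ xs) h = cong suc (length-codes xs (λ m → h (there m)))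

    ∈-codes : ∀ xs (h : Coded xs) {k} → k ∈ codes xs h → ∃ λ x → x ∈ xs × V k × Q x k
    ∈-codes (x ∷ xs) h (here refl) = x , here refl , proj₂ (h (here refl))
    ∈-codes (x ∷ xs) h (there m)   =
      let (y , y∈ , r) = ∈-codes xs (λ m → h (there m)) m in y , there y∈ , r

    Unique-codes : ∀ xs (h : Coded xs) → Unique xs → Unique (codes xs h)
    Unique-codes []       h _          = []
    Unique-codes (x ∷ xs) h (x∉ ∷ uxs) =
      All.tabulate (λ m e → let (y , y∈ , _ , qy) = ∈-codes xs (λ m → h (there m)) m in
                      All.lookup x∉ y∈ (Q-injective (proj₂ (proj₂ (h (here refl)))) (subst (Q y) (sym e) qy)))
      ∷ Unique-codes xs (λ m → h (there m)) uxs

  length≤sumBelow : ∀ N (c : ℕ → ℕ) (xs : List X) → Unique xs → Coded xs →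
                    (∀ {k} → V k → k < N × c k ≡ 1) → length xs ≤ sumBelow N c
  length≤sumBelow N c xs uxs h hv = subst (_≤ sumBelow N c) (length-codes xs h)
    (Unique-length≤sumBelow N c (codes xs h) (Unique-codes xs h uxs)
      (λ m → hv (proj₁ (proj₂ (proj₂ (∈-codes xs h m))))))

encode : ℕ → Bool → ℕ
encode m false = m + m
encode m true  = suc (m + m)

⌊encode/2⌋ : ∀ m b → ⌊ encode m b /2⌋ ≡ m
⌊encode/2⌋ zero    false = refl
⌊encode/2⌋ zero    true  = refl
⌊encode/2⌋ (suc m) false rewrite +-suc m m = cong suc (⌊encode/2⌋ m false)
⌊encode/2⌋ (suc m) true  rewrite +-suc m m = cong suc (⌊encode/2⌋ m true)

encode-injective : ∀ m b m′ b′ → encode m b ≡ encode m′ b′ → m ≡ m′ × b ≡ b′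
encode-injective m b m′ b′ e with trans (sym (⌊encode/2⌋ m b)) (trans (cong ⌊_/2⌋ e) (⌊encode/2⌋ m′ b′))
... | refl with b | b′
... | false | false = refl , refl
... | true  | true  = refl , refl
... | false | true  = ⊥-elim (<-irrefl e (n<1+n _))
... | true  | false = ⊥-elim (<-irrefl (sym e) (n<1+n _))

encode-< : ∀ m b N → m < N → encode m b < N + N
encode-< m false N m<N = <-≤-trans (+-monoˡ-< m m<N) (+-monoʳ-≤ N (<⇒≤ m<N))
encode-< m true  N m<N = ≤-trans (≤-reflexive (cong suc (sym (+-suc m m)))) (+-mono-≤ m<N m<N)

sumBelow-⌊/2⌋ : ∀ N c → sumBelow (N + N) (λ m → c ⌊ m /2⌋) ≡ sumBelow N c + sumBelow N c
sumBelow-⌊/2⌋ zero    c = refl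
sumBelow-⌊/2⌋ (suc N) c rewrite +-suc N N =
  trans (cong (λ z → c 0 + (c 0 + z)) (sumBelow-⌊/2⌋ N (λ m → c (suc m))))
        (regroup (c 0) (sumBelow N (λ m → c (suc m))))
  where
  regroup : ∀ a s → a + (a + (s + s)) ≡ (a + s) + (a + s)
  regroup = solve-∀

module Runs {Un : ℕ → Set} (Un? : ∀ y → Dec (Un y)) (N : ℕ) where

  runEnd : ℕ → ℕ → ℕ
  runEnd s zero    = s
  runEnd s (suc f) with Un? s
  ... | yes _ = runEnd (suc s) f
  ... | no  _ = s

  runEnd-≥ : ∀ s f → s ≤ runEnd s f
  runEnd-≥ s zero    = ≤-refl
  runEnd-≥ s (suc f) with Un? s
  ... | yes _ = ≤-trans (n≤1+n s) (runEnd-≥ (suc s) f)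
  ... | no  _ = ≤-refl

  runEnd-sound : ∀ s f z → s ≤ z → z < runEnd s f → Un z
  runEnd-sound s zero    z s≤z z<e = ⊥-elim (<-irrefl refl (≤-<-trans s≤z z<e))
  runEnd-sound s (suc f) z s≤z z<e with Un? s
  ... | no  _ = ⊥-elim (<-irrefl refl (≤-<-trans s≤z z<e))
  ... | yes u with s ≟ℕ z
  ...   | yes refl = u
  ...   | no  s≢z  = runEnd-sound (suc s) f z (≤∧≢⇒< s≤z s≢z) z<e

  runEnd-complete : ∀ s f y → s ≤ y → (∀ z → s ≤ z → z ≤ y → Un z) → y < s + f → y < runEnd s f
  runEnd-complete s zero    y s≤y _  y<s+0 = ⊥-elim (<-irrefl refl (≤-<-trans s≤y (subst (y <_) (+-identityʳ s) y<s+0)))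
  runEnd-complete s (suc f) y s≤y un y<s+f with Un? s
  ... | no ¬u = ⊥-elim (¬u (un s ≤-refl s≤y))
  ... | yes u with s ≟ℕ y
  ...   | yes refl = runEnd-≥ (suc s) f
  ...   | no  s≢y  = runEnd-complete (suc s) f y (≤∧≢⇒< s≤y s≢y)
                       (λ z s<z z≤y → un z (≤-trans (n≤1+n s) s<z) z≤y) (subst (y <_) (+-suc s f) y<s+f)

  RunStart : ℕ → Set
  RunStart y = Un y × (y ≡ 0 ⊎ ∃ λ y′ → y ≡ suc y′ × ¬ Un y′)

  runStart? : ∀ y → Dec (RunStart y)
  runStart? zero with Un? 0
  ... | yes u  = yes (u , inj₁ refl)
  ... | no ¬u  = no (λ r → ¬u (proj₁ r))
  runStart? (suc y) with Un? (suc y) | Un? y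
  ... | no ¬u | _     = no (λ r → ¬u (proj₁ r))
  ... | yes _ | yes u = no λ { (_ , inj₁ ()) ; (_ , inj₂ (_ , refl , ¬u)) → ¬u u }
  ... | yes u | no ¬u = yes (u , inj₂ (y , refl , ¬u))

  starts : List ℕ
  starts = filter runStart? (upTo N)

  Unique-starts : Unique starts
  Unique-starts = Unique-filter⁺ runStart? (upTo⁺ N)

  ∈-starts⁻ : ∀ {y} → y ∈ starts → y < N × RunStart y
  ∈-starts⁻ m with ∈-filter⁻ runStart? m
  ... | y∈ , r = ∈-upTo⁻ y∈ , r

  fragments : List (ℕ × ℕ)
  fragments = map (λ s → s , runEnd s (N ∸ s)) starts

  startOf : ℕ → ℕ
  startOf zero    = 0
  startOf (suc y) with Un? y
  ... | yes _ = startOf y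
  ... | no  _ = suc y

  startOf-spec : ∀ y → Un y → startOf y ≤ y × RunStart (startOf y) × (∀ z → startOf y ≤ z → z ≤ y → Un z)
  startOf-spec zero u = z≤n , (u , inj₁ refl) , λ { zero _ _ → u }
  startOf-spec (suc y) u with Un? y
  ... | yes u′ = let (s≤y , start , un) = startOf-spec y u′ in
    ≤-trans s≤y (n≤1+n y) , start , λ z s≤z z≤1+y → extend z z≤1+y (un z s≤z)
    where
    extend : ∀ z → z ≤ suc y → (z ≤ y → Un z) → Un z
    extend z z≤1+y h with z ≟ℕ suc y
    ... | yes refl = u
    ... | no  z≢   = h (≤-pred (≤∧≢⇒< z≤1+y z≢))
  ... | no ¬u = ≤-refl , (u , inj₂ (y , refl , ¬u)) , λ z lo hi → subst Un (≤-antisym lo hi) u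

  Un⇔InSomeFragment : ∀ y → y < N → Un y ⇔ InSomeFragment y fragments
  Un⇔InSomeFragment y y<N = mk⇔ to from
    where
    to : Un y → InSomeFragment y fragments
    to u = let (s≤y , start , un) = startOf-spec y u; s = startOf y in
      (s , runEnd s (N ∸ s)) ,
      ∈-map⁺ _ (∈-filter⁺ runStart? (∈-upTo⁺ (≤-<-trans s≤y y<N)) start) ,
      s≤y , runEnd-complete s (N ∸ s) y s≤y un (subst (y <_) (sym (m+[n∸m]≡n (<⇒≤ (≤-<-trans s≤y y<N)))) y<N)
    from : InSomeFragment y fragments → Un y
    from (_ , m , lo , hi) with ∈-map⁻ _ m
    ... | s , _ , refl = runEnd-sound s (N ∸ s) y lo hi

∣1+m-n∣≤1+∣m-n∣ : ∀ m n → ∣ suc m - n ∣ ≤ suc ∣ m - n ∣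
∣1+m-n∣≤1+∣m-n∣ zero    zero    = s≤s z≤n
∣1+m-n∣≤1+∣m-n∣ zero    (suc n) = ≤-trans (n≤1+n n) (n≤1+n _)
∣1+m-n∣≤1+∣m-n∣ (suc m) zero    = ≤-refl
∣1+m-n∣≤1+∣m-n∣ (suc m) (suc n) = ∣1+m-n∣≤1+∣m-n∣ m n

∣m-1+n∣≤1+∣m-n∣ : ∀ m n → ∣ m - suc n ∣ ≤ suc ∣ m - n ∣
∣m-1+n∣≤1+∣m-n∣ m n = subst₂ (λ u v → u ≤ suc v) (∣-∣-comm (suc n) m) (∣-∣-comm n m) (∣1+m-n∣≤1+∣m-n∣ n m)

_≟Step_ : DecidableEquality Step
del ≟Step del = yes refl
ins ≟Step ins = yes refl
ali ≟Step ali = yes refl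
del ≟Step ins = no (λ ())
del ≟Step ali = no (λ ())
ins ≟Step del = no (λ ())
ins ≟Step ali = no (λ ())
ali ≟Step del = no (λ ())
ali ≟Step ins = no (λ ())

module Alignment {A : Set} (_≟_ : DecidableEquality A) (F G : List (Paren A)) (k : ℕ)
                 (BF : Bal F) (BG : Bal G) (P : List Step) (isA : IsAlignment F G P)
                 (cost2≤2k : cost2 _≟_ F G (tagged 0 0 P) ≤ 2 * k) where

  open Stack _≟_
  open Mates _≟_
  open Geometry P
  open IsAlignment isA

  X-end : X L ≡ length F
  X-end = cong proj₁ (trans (sym (endpoint≡At-length 0 0 P)) ends)

  Y-end : Y L ≡ length G
  Y-end = cong proj₂ (trans (sym (endpoint≡At-length 0 0 P)) ends)

  cost : ℕ → ℕ
  cost n = stepCost2 _≟_ (S n) (at F (X n)) (at G (Y n))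

  total-cost≤2k : sumBelow L cost ≤ 2 * k
  total-cost≤2k = subst (_≤ 2 * k) (cost2≡sumBelow _≟_ F G 0 0 P) cost2≤2k

  module Cost-counter = Counter L (λ n → sumBelow n cost) cost (λ n _ → sumBelow-suc n cost) refl

  cost≡0⊎1 : ∀ n → cost n ≡ 0 ⊎ cost n ≡ 1
  cost≡0⊎1 n = go (S n) (at F (X n)) (at G (Y n))
    where
    go : ∀ s u v → stepCost2 _≟_ s u v ≡ 0 ⊎ stepCost2 _≟_ s u v ≡ 1
    go del u v = inj₂ refl
    go ins u v = inj₂ refl
    go ali nothing  v        = inj₂ refl
    go ali (just p) nothing  = inj₂ refl
    go ali (just p) (just q) with label p ≟ label q
    ... | yes _ = inj₁ refl
    ... | no  _ = inj₂ refl

  del⇒cost≡1 : ∀ n → S n ≡ del → cost n ≡ 1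
  del⇒cost≡1 n e rewrite e = refl

  ins⇒cost≡1 : ∀ n → S n ≡ ins → cost n ≡ 1
  ins⇒cost≡1 n e rewrite e = refl

  cost≡0⇒aligned : ∀ n → cost n ≡ 0 → S n ≡ ali
  cost≡0⇒aligned n c≡0 with S n
  ... | ali = refl
  ... | del = ⊥-elim (0≢1+n (sym c≡0))
  ... | ins = ⊥-elim (0≢1+n (sym c≡0))

  free-ali⇒same-label : ∀ u v → stepCost2 _≟_ ali u v ≡ 0 →
                        ∃ λ p → ∃ λ q → u ≡ just p × v ≡ just q × label p ≡ label q
  free-ali⇒same-label (just p) (just q) e with label p ≟ label q
  ... | yes same = p , q , refl , refl , same

  width≤cost-so-far : ∀ n → n ≤ L → ∣ X n - Y n ∣ ≤ sumBelow n cost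
  width≤cost-so-far zero    _   = z≤n
  width≤cost-so-far (suc n) n<L =
    subst₂ (λ u v → ∣ u - v ∣ ≤ sumBelow (suc n) cost) (sym (xAt-suc P n n<L)) (sym (yAt-suc P n n<L))
      (subst (∣ X n + Δx (S n) - (Y n + Δy (S n)) ∣ ≤_) (sym (sumBelow-suc n cost))
        (step (X n) (Y n) (S n) (width≤cost-so-far n (<⇒≤ n<L)) (del⇒cost≡1 n) (ins⇒cost≡1 n)))
    where
    step : ∀ a b s → ∣ a - b ∣ ≤ sumBelow n cost → (s ≡ del → cost n ≡ 1) → (s ≡ ins → cost n ≡ 1) →
           ∣ a + Δx s - (b + Δy s) ∣ ≤ sumBelow n cost + cost n
    step a b del h d _ rewrite d refl | +-identityʳ b | +-comm a 1 | +-comm (sumBelow n cost) 1 =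
      ≤-trans (∣1+m-n∣≤1+∣m-n∣ a b) (s≤s h)
    step a b ins h _ i rewrite i refl | +-identityʳ a | +-comm b 1 | +-comm (sumBelow n cost) 1 =
      ≤-trans (∣m-1+n∣≤1+∣m-n∣ a b) (s≤s h)
    step a b ali h _ _ rewrite +-comm a 1 | +-comm b 1 = ≤-trans h (m≤m+n _ (cost n))

  width≤2k : WidthAtMost P (2 * k)
  width≤2k x y m with ∈-verts⁻ 0 0 P m
  ... | n , n≤L , refl = ≤-trans (width≤cost-so-far n n≤L) (≤-trans (Cost-counter.mono n L n≤L ≤-refl) total-cost≤2k)

  -- An opening parenthesis aligned with a closing one (or vice versa) would, by consistency,
  -- force the alignment to cross itself between the two mated pairs.
  same-label⇒same-paren : ∀ {x y u v} → Aligned P x y → at F x ≡ just u → at G y ≡ just v →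
                          label u ≡ label v → u ≡ v
  same-label⇒same-paren {u = op a} {op b} _ _ _ refl = refl
  same-label⇒same-paren {u = cl a} {cl b} _ _ _ refl = refl
  same-label⇒same-paren {x} {y} {op a} {cl b} al e₁ e₂ refl
    with open-has-mate BF x a e₁ | close-has-mate BG y a e₂
  ... | x′ , mF | y′ , mG =
    ⊥-elim (<-asym (proj₁ mG) (aligned-monotone al (consist x y x′ y′ al (inj₁ mF) (inj₂ mG)) (proj₁ mF)))
  same-label⇒same-paren {x} {y} {cl a} {op b} al e₁ e₂ refl
    with close-has-mate BF x a e₁ | open-has-mate BG y a e₂
  ... | x′ , mF | y′ , mG =
    ⊥-elim (<-asym (proj₁ mG) (aligned-monotone (consist x y x′ y′ al (inj₂ mF) (inj₁ mG)) al (proj₁ mF)))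

  Hits : ℕ × ℕ → ℕ → Set
  Hits (p , q) n = (Δx (S n) ≡ 1 × p ≤ X n × X n < q) ⊎ (S n ≡ ins × p < X n × X n < q)

  CostFree : ℕ × ℕ → Set
  CostFree iv = ∀ n → n < L → cost n ≡ 1 → ¬ Hits iv n

  FreeAlignedAt : ℕ → ℕ → ℕ → Set
  FreeAlignedAt n x y = AlignedAt n x y × cost n ≡ 0

  FreeAlignedAt⇒at≡ : ∀ {n x y} → FreeAlignedAt n x y → at F x ≡ at G y
  FreeAlignedAt⇒at≡ {n} (al@(n<L , sn , refl , refl) , c≡0)
    with free-ali⇒same-label _ _ (subst (λ s → stepCost2 _≟_ s (at F (X n)) (at G (Y n)) ≡ 0) sn c≡0)
  ... | u , v , eu , ev , same = trans eu (trans (cong just (same-label⇒same-paren (AlignedAt⇒aligned al) eu ev same)) (sym ev))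

  ali⇒X-suc : ∀ {n} → n < L → S n ≡ ali → X (suc n) ≡ suc (X n)
  ali⇒X-suc {n} n<L sn = trans (xAt-suc P n n<L) (trans (cong (X n +_) (ali⇒Δx≡1 sn)) (+-comm (X n) 1))

  ali⇒Y-suc : ∀ {n} → n < L → S n ≡ ali → Y (suc n) ≡ suc (Y n)
  ali⇒Y-suc {n} n<L sn = trans (yAt-suc P n n<L) (trans (cong (Y n +_) (ali⇒Δy≡1 sn)) (+-comm (Y n) 1))

  del⊎ali⇒Δx≡1 : ∀ {n} → S n ≡ del ⊎ S n ≡ ali → Δx (S n) ≡ 1
  del⊎ali⇒Δx≡1 = [ cong Δx , cong Δx ]′

  consumed⇒X<∣F∣ : ∀ {n} → n < L → Δx (S n) ≡ 1 → X n < length F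
  consumed⇒X<∣F∣ {n} n<L Δx≡1 = subst (X n <_) X-end (X-counter.strict n L n<L ≤-refl Δx≡1)

  CostFree-consumed : ∀ {p q n} → CostFree (p , q) → n < L → Δx (S n) ≡ 1 → p ≤ X n → X n < q →
                      S n ≡ ali × cost n ≡ 0
  CostFree-consumed {n = n} free n<L Δx≡1 p≤x x<q with cost≡0⊎1 n
  ... | inj₁ c≡0 = cost≡0⇒aligned n c≡0 , c≡0
  ... | inj₂ c≡1 = ⊥-elim (free n n<L c≡1 (inj₁ (Δx≡1 , p≤x , x<q)))

  CostFree-next : ∀ {p q n} → CostFree (p , q) → q ≤ length F → n < L → S n ≡ ali → p ≤ X n → suc (X n) < q →
                  suc n < L × S (suc n) ≡ ali × cost (suc n) ≡ 0
  CostFree-next {p} {q} {n} free q≤∣F∣ n<L sn p≤x 1+x<q with suc n <? L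
  ... | no 1+n≮L = ⊥-elim (<-irrefl refl (<-≤-trans (subst (_< q) (sym (ali⇒X-suc n<L sn)) 1+x<q)
                                              (subst (q ≤_) (sym (trans (cong X (≤-antisym n<L (≮⇒≥ 1+n≮L))) X-end)) q≤∣F∣)))
  ... | yes 1+n<L with cost≡0⊎1 (suc n)
  ...   | inj₁ c≡0 = 1+n<L , cost≡0⇒aligned (suc n) c≡0 , c≡0
  ...   | inj₂ c≡1 = ⊥-elim (free (suc n) 1+n<L c≡1 (hit (S (suc n)) refl))
    where
    X-suc : X (suc n) ≡ suc (X n)
    X-suc = ali⇒X-suc n<L sn
    hit : ∀ s → S (suc n) ≡ s → Hits (p , q) (suc n)
    hit del e = inj₁ (cong Δx e , subst (p ≤_) (sym X-suc) (≤-trans p≤x (n≤1+n _)) , subst (_< q) (sym X-suc) 1+x<q)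
    hit ali e = inj₁ (cong Δx e , subst (p ≤_) (sym X-suc) (≤-trans p≤x (n≤1+n _)) , subst (_< q) (sym X-suc) 1+x<q)
    hit ins e = inj₂ (e , subst (p <_) (sym X-suc) (s≤s p≤x) , subst (_< q) (sym X-suc) 1+x<q)

  CostFree⇒diagonal : ∀ p q → p < q → q ≤ length F → CostFree (p , q) →
                      ∃ λ a → ∀ t → p + t < q → ∃ λ n → FreeAlignedAt n (p + t) (a + t)
  CostFree⇒diagonal p q p<q q≤∣F∣ free
    with X-counter.hits (λ n → Δx≤1 (S n)) L ≤-refl p (subst (p <_) (sym X-end) (<-≤-trans p<q q≤∣F∣))
  ... | n₀ , n₀<L , xn₀ , Δx≡1 = Y n₀ , run
    where
    run : ∀ t → p + t < q → ∃ λ n → FreeAlignedAt n (p + t) (Y n₀ + t)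
    run zero p+0<q with CostFree-consumed free n₀<L Δx≡1 (≤-reflexive (sym xn₀)) (subst (_< q) (sym xn₀) p<q)
    ... | sn , c≡0 = n₀ , (n₀<L , sn , trans xn₀ (sym (+-identityʳ p)) , sym (+-identityʳ (Y n₀))) , c≡0
    run (suc t) p+1+t<q with run t (<-trans (+-monoʳ-< p (n<1+n t)) p+1+t<q)
    ... | n , (n<L , sn , xn , yn) , _
      with CostFree-next free q≤∣F∣ n<L sn (subst (p ≤_) (sym xn) (m≤m+n p t))
                                           (subst (_< q) (trans (+-suc p t) (cong suc (sym xn))) p+1+t<q)
    ... | 1+n<L , s1+n , c≡0 =
      suc n , (1+n<L , s1+n , trans (ali⇒X-suc n<L sn) (trans (cong suc xn) (sym (+-suc p t)))
                            , trans (ali⇒Y-suc n<L sn) (trans (cong suc yn) (sym (+-suc (Y n₀) t)))) , c≡0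

  -- If a context of F is matched diagonally onto X·N·Y in G, then N is balanced: a crossing
  -- parenthesis would be mated into Y in F but into N in G, so consistency would align a
  -- closing parenthesis of Y with a position of N, before the image of Y.
  image-hole-Bal : ∀ F₀ X′ M Y′ F₁ G₀ N G₁ → F ≡ F₀ ++ X′ ++ M ++ Y′ ++ F₁ → G ≡ G₀ ++ X′ ++ N ++ Y′ ++ G₁ →
    (∀ t → t < length X′ → Aligned P (length F₀ + t) (length G₀ + t)) →
    (∀ t → t < length Y′ → Aligned P (length (F₀ ++ X′ ++ M) + t) (length (G₀ ++ X′ ++ N) + t)) →
    Bal M → Bal (X′ ++ M ++ Y′) → Bal (X′ ++ N ++ Y′) → Bal N
  image-hole-Bal F₀ X′ M Y′ F₁ G₀ N G₁ eF eG alX alY bM bF bG with hole-Bal⊎Crossing X′ M N Y′ bM bF bG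
  ... | inj₁ bN = bN
  ... | inj₂ (crossing e X₀ C B N′ B′ Y″ refl refl refl bC bB bB′) = ⊥-elim (<-irrefl G-positions G-before)
    where
    mG : Matched G (length (G₀ ++ X₀)) (length (G₀ ++ X₀) + suc (length (C ++ B)))
    mG = Matched-++ (G₀ ++ X₀) e (C ++ B) (N′ ++ Y′ ++ G₁) (trans eG (++-reassoc G₀ X₀ C B N′ (Y′ ++ G₁) (op e) (cl e)))
                    (Bal-++ bC bB)
    mF : Matched F (length (F₀ ++ X₀)) (length (F₀ ++ X₀) + suc (length (C ++ M ++ B′)))
    mF = Matched-++ (F₀ ++ X₀) e (C ++ M ++ B′) (Y″ ++ F₁)
                    (trans eF (trans (cong (λ T → F₀ ++ X′ ++ T) (sym (++-assoc M (B′ ++ cl e ∷ Y″) F₁)))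
                    (trans (cong (λ T → F₀ ++ X′ ++ T ++ F₁) (sym (++-assoc M B′ (cl e ∷ Y″))))
                           (++-reassoc F₀ X₀ C (M ++ B′) Y″ F₁ (op e) (cl e)))))
                    (Bal-++ bC (Bal-++ bM bB′))
    ∣X′∣ : length X′ ≡ length X₀ + suc (length C)
    ∣X′∣ = length-++ X₀
    open-aligned : Aligned P (length (F₀ ++ X₀)) (length (G₀ ++ X₀))
    open-aligned = subst₂ (Aligned P) (sym (length-++ F₀)) (sym (length-++ G₀))
                     (alX (length X₀) (subst (length X₀ <_) (sym ∣X′∣) (m<m+n (length X₀) (s≤s z≤n))))
    close-aligned : Aligned P (length (F₀ ++ X₀) + suc (length (C ++ M ++ B′))) (length (G₀ ++ X₀) + suc (length (C ++ B)))
    close-aligned = consist _ _ _ _ open-aligned (inj₁ mF) (inj₁ mG)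
    close-in-Y′ : Aligned P (length (F₀ ++ X′ ++ M) + length B′) (length (G₀ ++ X′ ++ (B ++ cl e ∷ N′)) + length B′)
    close-in-Y′ = alY (length B′) (subst (length B′ <_) (sym (length-++ B′)) (m<m+n (length B′) (s≤s z≤n)))
    G-positions : length (G₀ ++ X₀) + suc (length (C ++ B)) ≡ length (G₀ ++ X′ ++ (B ++ cl e ∷ N′)) + length B′
    G-positions = aligned-functional
      (subst (λ z → Aligned P z (length (G₀ ++ X₀) + suc (length (C ++ B)))) (length-crossing≡ F₀ X₀ C M B′ (op e))
             close-aligned)
      close-in-Y′
    G-before : length (G₀ ++ X₀) + suc (length (C ++ B)) < length (G₀ ++ X′ ++ (B ++ cl e ∷ N′)) + length B′
    G-before = length-crossing< G₀ X₀ C B N′ B′ (op e) (cl e)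

  image-hole-Bal-at : ∀ {f₀ f₁ f₂ f₃ g₀ g₁ g₂ g₃} →
    f₀ ≤ f₁ → f₁ ≤ f₂ → f₂ ≤ f₃ → f₃ ≤ length F → g₀ ≤ g₁ → g₁ ≤ g₂ → g₂ ≤ g₃ → g₃ ≤ length G →
    frag F f₀ f₁ ≡ frag G g₀ g₁ → frag F f₂ f₃ ≡ frag G g₂ g₃ →
    (∀ t → t < f₁ ∸ f₀ → Aligned P (f₀ + t) (g₀ + t)) → (∀ t → t < f₃ ∸ f₂ → Aligned P (f₂ + t) (g₂ + t)) →
    Bal (frag F f₁ f₂) → Bal (frag F f₀ f₃) → Bal (frag G g₀ g₃) → Bal (frag G g₁ g₂)
  image-hole-Bal-at {f₀} {f₁} {f₂} {f₃} {g₀} {g₁} {g₂} {g₃}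
                    f₀≤f₁ f₁≤f₂ f₂≤f₃ f₃≤∣F∣ g₀≤g₁ g₁≤g₂ g₂≤g₃ g₃≤∣G∣ X≡ Y≡ alX alY bM bF bG =
    image-hole-Bal (take f₀ F) X′ M Y′ (drop f₃ F) (take g₀ G) N (drop g₃ G)
      (split-at-four F f₀ f₁ f₂ f₃ f₀≤f₁ f₁≤f₂ f₂≤f₃)
      (trans (split-at-four G g₀ g₁ g₂ g₃ g₀≤g₁ g₁≤g₂ g₂≤g₃)
             (cong₂ (λ U V → take g₀ G ++ U ++ N ++ V ++ drop g₃ G) (sym X≡) (sym Y≡)))
      alX′ alY′ bM
      (subst Bal (frag-++-++ F f₀ f₁ f₂ f₃ f₀≤f₁ f₁≤f₂ f₂≤f₃) bF)
      (subst Bal (trans (frag-++-++ G g₀ g₁ g₂ g₃ g₀≤g₁ g₁≤g₂ g₂≤g₃)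
                        (cong₂ (λ U V → U ++ N ++ V) (sym X≡) (sym Y≡))) bG)
    where
    X′ M Y′ N : List (Paren A)
    X′ = frag F f₀ f₁
    M  = frag F f₁ f₂
    Y′ = frag F f₂ f₃
    N  = frag G g₁ g₂
    f₂≤∣F∣ : f₂ ≤ length F
    f₂≤∣F∣ = ≤-trans f₂≤f₃ f₃≤∣F∣
    f₁≤∣F∣ : f₁ ≤ length F
    f₁≤∣F∣ = ≤-trans f₁≤f₂ f₂≤∣F∣
    g₂≤∣G∣ : g₂ ≤ length G
    g₂≤∣G∣ = ≤-trans g₂≤g₃ g₃≤∣G∣
    alX′ : ∀ t → t < length X′ → Aligned P (length (take f₀ F) + t) (length (take g₀ G) + t)
    alX′ t t< = subst₂ (λ u v → Aligned P (u + t) (v + t))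
                  (sym (length-take-≤ F f₀ (≤-trans f₀≤f₁ f₁≤∣F∣)))
                  (sym (length-take-≤ G g₀ (≤-trans g₀≤g₁ (≤-trans g₁≤g₂ g₂≤∣G∣))))
                  (alX t (subst (t <_) (length-frag F f₀ f₁ f₀≤f₁ f₁≤∣F∣) t<))
    alY′ : ∀ t → t < length Y′ → Aligned P (length (take f₀ F ++ X′ ++ M) + t) (length (take g₀ G ++ X′ ++ N) + t)
    alY′ t t< = subst₂ (λ u v → Aligned P (u + t) (v + t))
                  (sym (length-take++frag++frag F f₀ f₁ f₂ f₀≤f₁ f₁≤f₂ f₂≤∣F∣))
                  (sym (trans (cong (λ U → length (take g₀ G ++ U ++ N)) X≡)
                              (length-take++frag++frag G g₀ g₁ g₂ g₀≤g₁ g₁≤g₂ g₂≤∣G∣)))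
                  (alY t (subst (t <_) (length-frag F f₂ f₃ f₂≤f₃ f₃≤∣F∣) t<))

  DiagonalImage : ℕ → ℕ → ℕ → Set
  DiagonalImage p ℓ a = p + ℓ ≤ length F × a + ℓ ≤ length G ×
    (∀ t → t < ℓ → Aligned P (p + t) (a + t) × at F (p + t) ≡ at G (a + t))

  CostFree⇒DiagonalImage : ∀ p ℓ → p + suc ℓ ≤ length F → CostFree (p , p + suc ℓ) → ∃ (DiagonalImage p (suc ℓ))
  CostFree⇒DiagonalImage p ℓ ≤∣F∣ free with CostFree⇒diagonal p (p + suc ℓ) (m<m+n p (s≤s z≤n)) ≤∣F∣ free
  ... | a , run = a , ≤∣F∣ , ≤∣G∣ , pointwise
    where
    pointwise : ∀ t → t < suc ℓ → Aligned P (p + t) (a + t) × at F (p + t) ≡ at G (a + t)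
    pointwise t t<ℓ with run t (+-monoʳ-< p t<ℓ)
    ... | n , fa = AlignedAt⇒aligned (proj₁ fa) , FreeAlignedAt⇒at≡ fa
    ≤∣G∣ : a + suc ℓ ≤ length G
    ≤∣G∣ with <⇒at-just F (p + ℓ) (<-≤-trans (+-monoʳ-< p (n<1+n ℓ)) ≤∣F∣)
    ... | _ , e = subst (_≤ length G) (sym (+-suc a ℓ))
                    (at-just⇒< G (a + ℓ) (trans (sym (proj₂ (pointwise ℓ ≤-refl))) e))

  DiagonalImage⇒frag≡ : ∀ {p ℓ a} → DiagonalImage p ℓ a → ∀ s r {p′ q′ a′ b′} → s + r ≤ ℓ →
    p′ ≡ p + s → q′ ≡ p′ + r → a′ ≡ a + s → b′ ≡ a′ + r → frag F p′ q′ ≡ frag G a′ b′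
  DiagonalImage⇒frag≡ {p} {ℓ} {a} (≤∣F∣ , ≤∣G∣ , pw) s r s+r≤ℓ refl refl refl refl =
    frag-pointwise F G (p + s) (a + s) r
      (λ t t<r → subst₂ (λ u v → at F u ≡ at G v) (sym (+-assoc p s t)) (sym (+-assoc a s t))
                   (proj₂ (pw (s + t) (<-≤-trans (+-monoʳ-< s t<r) s+r≤ℓ))))
      (≤-trans (≤-reflexive (+-assoc p s r)) (≤-trans (+-monoʳ-≤ p s+r≤ℓ) ≤∣F∣))
      (≤-trans (≤-reflexive (+-assoc a s r)) (≤-trans (+-monoʳ-≤ a s+r≤ℓ) ≤∣G∣))

  DiagonalImage-onto : ∀ {p ℓ a} → DiagonalImage p ℓ a → ∀ y → a ≤ y → y < a + ℓ →
                       ∃ λ x → (p ≤ x × x < p + ℓ) × Aligned P x y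
  DiagonalImage-onto {p} {ℓ} {a} (_ , _ , pw) y a≤y y<a+ℓ =
    p + (y ∸ a) , (m≤m+n p _ , +-monoʳ-< p offset<ℓ) ,
    subst (Aligned P (p + (y ∸ a))) (m+[n∸m]≡n a≤y) (proj₁ (pw (y ∸ a) offset<ℓ))
    where
    offset<ℓ : y ∸ a < ℓ
    offset<ℓ = +-cancelˡ-< a _ _ (subst (_< a + ℓ) (sym (m+[n∸m]≡n a≤y)) y<a+ℓ)

  DiagonalImage-into : ∀ {p ℓ a} → DiagonalImage p ℓ a → ∀ x y → p ≤ x → x < p + ℓ → Aligned P x y →
                       a ≤ y × y < a + ℓ
  DiagonalImage-into {p} {ℓ} {a} (_ , _ , pw) x y p≤x x<p+ℓ al
    with aligned-functional (subst (λ z → Aligned P z y) (sym (m+[n∸m]≡n p≤x)) al) (proj₁ (pw (x ∸ p) offset<ℓ))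
    where
    offset<ℓ : x ∸ p < ℓ
    offset<ℓ = +-cancelˡ-< p _ _ (subst (_< p + ℓ) (sym (m+[n∸m]≡n p≤x)) x<p+ℓ)
  ... | refl = m≤m+n a _ , +-monoʳ-< a (+-cancelˡ-< p _ _ (subst (_< p + ℓ) (sym (m+[n∸m]≡n p≤x)) x<p+ℓ))

  Hit : Piece → Set
  Hit d = ∃ λ n → n < L × cost n ≡ 1 × ∃ λ b → Hits (arm d b) n

  ¬Hit⇒CostFree : ∀ {d} → ¬ Hit d → ∀ b → CostFree (arm d b)
  ¬Hit⇒CostFree ¬hit b n n<L c≡1 h = ¬hit (n , n<L , c≡1 , b , h)

  Image : Piece → Piece → Set
  Image d g = (∀ y → InPiece y g → ∃ λ b → ∃ λ x → InArm d b x × Aligned P x y) ×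
              (∀ b x y → InArm d b x → Aligned P x y → InPiece y g)

  PerfectImage : Piece → Set
  PerfectImage d = ∃ λ g → PerfectMatch F G P d g × IsPiece G g × Image d g

  <⇒≡+suc : ∀ {p q} → p < q → ∃ λ m → q ≡ p + suc m
  <⇒≡+suc {p} p<q with m≤n⇒∃[o]m+o≡n p<q
  ... | m , refl = m , sym (+-suc p m)

  subforest-PerfectImage : ∀ i j → WellFormed F (sub i j) → ¬ Hit (sub i j) → PerfectImage (sub i j)
  subforest-PerfectImage i j (i<j , _ , j≤∣F∣ , bal) ¬hit with <⇒≡+suc i<j
  ... | ℓ , refl with CostFree⇒DiagonalImage i ℓ j≤∣F∣ (¬Hit⇒CostFree {sub i (i + suc ℓ)} ¬hit false)
  ... | a , im@(_ , ≤∣G∣ , pw) =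
    sub a (a + suc ℓ) ,
    (frag≡ , λ t t<ℓ → proj₁ (pw t (subst (t <_) (m+n∸m≡n i (suc ℓ)) t<ℓ))) ,
    (m≤m+n a _ , ≤∣G∣ , subst Bal frag≡ bal) ,
    (λ { y (a≤y , y<) → let (x , x∈ , al) = DiagonalImage-onto im y a≤y y< in false , x , x∈ , al }) ,
    λ { false x y (i≤x , x<) al → DiagonalImage-into im x y i≤x x< al }
    where
    frag≡ : frag F i (i + suc ℓ) ≡ frag G a (a + suc ℓ)
    frag≡ = DiagonalImage⇒frag≡ im 0 (suc ℓ) ≤-refl (sym (+-identityʳ i)) refl (sym (+-identityʳ a)) refl

  context-outer-Matched : ∀ {i l₁ j′ l₂ a b′} → DiagonalImage i (suc l₁) a → DiagonalImage j′ (suc l₂) b′ →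
                          Matched F i (j′ + l₂) → Matched G a (b′ + l₂)
  context-outer-Matched {i} {l₁} {j′} {l₂} {a} {b′} (_ , _ , pw₁) (_ , _ , pw₂) mF@(_ , _ , e , Fi≡ , _) =
    subst (Matched G a) (aligned-functional close-aligned (proj₁ (pw₂ l₂ (n<1+n l₂)))) (proj₂ mate)
    where
    open-aligned : Aligned P i a
    open-aligned = subst₂ (Aligned P) (+-identityʳ i) (+-identityʳ a) (proj₁ (pw₁ 0 (s≤s z≤n)))
    Ga≡ : at G a ≡ just (op e)
    Ga≡ = trans (sym (subst₂ (λ u v → at F u ≡ at G v) (+-identityʳ i) (+-identityʳ a) (proj₂ (pw₁ 0 (s≤s z≤n))))) Fi≡
    mate : ∃ λ q → Matched G a q
    mate = open-has-mate BG a e Ga≡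
    close-aligned : Aligned P (j′ + l₂) (proj₁ mate)
    close-aligned = consist i a _ _ open-aligned (inj₁ mF) (inj₁ (proj₂ mate))

  context-hole-Bal : ∀ {i l₁ j′ l₂ a b′} → DiagonalImage i (suc l₁) a → DiagonalImage j′ (suc l₂) b′ →
    i + suc l₁ ≤ j′ → a + suc l₁ ≤ b′ → Bal (frag F (i + suc l₁) j′) →
    Matched F i (j′ + l₂) → Matched G a (b′ + l₂) → Bal (frag G (a + suc l₁) b′)
  context-hole-Bal {i} {l₁} {j′} {l₂} {a} {b′} im₁@(_ , _ , pw₁) im₂@(_ , _ , pw₂) i′≤j′ a′≤b′ bM
                   (_ , <∣F∣ , _ , _ , _ , bF) (_ , <∣G∣ , _ , _ , _ , bG) =
    image-hole-Bal-at (1+p≤p+1+q i l₁) i′≤j′ (m≤m+n j′ l₂) (<⇒≤ <∣F∣)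
                      (1+p≤p+1+q a l₁) a′≤b′ (m≤m+n b′ l₂) (<⇒≤ <∣G∣)
      (DiagonalImage⇒frag≡ im₁ 1 l₁ ≤-refl (sym (+-comm i 1)) (+-suc i l₁) (sym (+-comm a 1)) (+-suc a l₁))
      (DiagonalImage⇒frag≡ im₂ 0 l₂ (n≤1+n l₂) (sym (+-identityʳ j′)) refl (sym (+-identityʳ b′)) refl)
      (λ t t< → subst₂ (Aligned P) (+-suc i t) (+-suc a t)
                  (proj₁ (pw₁ (suc t) (s≤s (subst (t <_) (trans (cong (_∸ suc i) (+-suc i l₁)) (m+n∸m≡n i l₁)) t<)))))
      (λ t t< → proj₁ (pw₂ t (≤-trans (subst (t <_) (m+n∸m≡n j′ l₂) t<) (n≤1+n l₂))))
      bM bF bG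
    where
    1+p≤p+1+q : ∀ p q → suc p ≤ p + suc q
    1+p≤p+1+q p q = subst (suc p ≤_) (sym (+-suc p q)) (s≤s (m≤m+n p q))

  context-PerfectImage : ∀ i i′ j′ j → WellFormed F (ctx i i′ j′ j) → ¬ Hit (ctx i i′ j′ j) → PerfectImage (ctx i i′ j′ j)
  context-PerfectImage i i′ j′ j (i<i′ , i′≤j′ , j′<j , j≤∣F∣ , mF , (_ , _ , bM)) ¬hit
    with <⇒≡+suc i<i′ | <⇒≡+suc j′<j
  ... | l₁ , refl | l₂ , refl
    with CostFree⇒DiagonalImage i l₁ (≤-trans i′≤j′ (≤-trans (m≤m+n j′ (suc l₂)) j≤∣F∣)) (¬Hit⇒CostFree {d} ¬hit false)
       | CostFree⇒DiagonalImage j′ l₂ j≤∣F∣ (¬Hit⇒CostFree {d} ¬hit true)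
    where
    d : Piece
    d = ctx i (i + suc l₁) j′ (j′ + suc l₂)
  ... | a , im₁@(_ , _ , pw₁) | b′ , im₂@(_ , ≤∣G∣ , pw₂) =
    ctx a (a + suc l₁) b′ (b′ + suc l₂) ,
    (DiagonalImage⇒frag≡ im₁ 0 (suc l₁) ≤-refl (sym (+-identityʳ i)) refl (sym (+-identityʳ a)) refl ,
     DiagonalImage⇒frag≡ im₂ 0 (suc l₂) ≤-refl (sym (+-identityʳ j′)) refl (sym (+-identityʳ b′)) refl ,
     (λ t t< → proj₁ (pw₁ t (subst (t <_) (m+n∸m≡n i (suc l₁)) t<))) ,
     (λ t t< → proj₁ (pw₂ t (subst (t <_) (m+n∸m≡n j′ (suc l₂)) t<)))) ,
    (m<m+n a (s≤s z≤n) , a′≤b′ , m<m+n b′ (s≤s z≤n) , ≤∣G∣ , subst (Matched G a) (sym last≡) mG ,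
     (a′≤b′ , ≤-trans (m≤m+n b′ _) ≤∣G∣ , context-hole-Bal im₁ im₂ i′≤j′ a′≤b′ bM mF′ mG)) ,
    onto , into
    where
    last≡ : ∀ {p} → (p + suc l₂) ∸ 1 ≡ p + l₂
    last≡ {p} = cong (_∸ 1) (+-suc p l₂)
    mF′ : Matched F i (j′ + l₂)
    mF′ = subst (Matched F i) last≡ mF
    mG : Matched G a (b′ + l₂)
    mG = context-outer-Matched im₁ im₂ mF′
    a′≤b′ : a + suc l₁ ≤ b′
    a′≤b′ = subst₂ _≤_ (sym (+-suc a l₁)) (+-identityʳ b′)
              (aligned-monotone (proj₁ (pw₁ l₁ (n<1+n l₁))) (proj₁ (pw₂ 0 (s≤s z≤n)))
                (<-≤-trans (+-monoʳ-< i (n<1+n l₁)) (≤-trans i′≤j′ (≤-reflexive (sym (+-identityʳ j′))))))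
    onto : ∀ y → InPiece y (ctx a (a + suc l₁) b′ (b′ + suc l₂)) →
           ∃ λ b → ∃ λ x → InArm (ctx i (i + suc l₁) j′ (j′ + suc l₂)) b x × Aligned P x y
    onto y (inj₁ (lo , hi)) = let (x , x∈ , al) = DiagonalImage-onto im₁ y lo hi in false , x , x∈ , al
    onto y (inj₂ (lo , hi)) = let (x , x∈ , al) = DiagonalImage-onto im₂ y lo hi in true , x , x∈ , al
    into : ∀ b x y → InArm (ctx i (i + suc l₁) j′ (j′ + suc l₂)) b x → Aligned P x y →
           InPiece y (ctx a (a + suc l₁) b′ (b′ + suc l₂))
    into false x y (lo , hi) al = inj₁ (DiagonalImage-into im₁ x y lo hi al)
    into true  x y (lo , hi) al = inj₂ (DiagonalImage-into im₂ x y lo hi al)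

  ¬Hit⇒PerfectImage : ∀ d → WellFormed F d → ¬ Hit d → PerfectImage d
  ¬Hit⇒PerfectImage (sub i j)       = subforest-PerfectImage i j
  ¬Hit⇒PerfectImage (ctx i i′ j′ j) = context-PerfectImage i i′ j′ j

  hits? : ∀ iv n → Dec (Hits iv n)
  hits? (p , q) n = ((Δx (S n) ≟ℕ 1) ×-dec ((p ≤? X n) ×-dec (X n <? q)))
               ⊎-dec ((S n ≟Step ins) ×-dec ((p <? X n) ×-dec (X n <? q)))

  hit? : ∀ d → Dec (Hit d)
  hit? d = anyUpTo? (λ n → (cost n ≟ℕ 1) ×-dec some-arm n) L
    where
    some-arm : ∀ n → Dec (∃ λ b → Hits (arm d b) n)
    some-arm n with hits? (arm d false) n | hits? (arm d true) n
    ... | yes h  | _      = yes (false , h)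
    ... | no  _  | yes h  = yes (true , h)
    ... | no ¬h₁ | no ¬h₂ = no λ { (false , h) → ¬h₁ h ; (true , h) → ¬h₂ h }

  Hits⇒InArm : ∀ d b {n} → Hits (arm d b) n → InArm d b (X n)
  Hits⇒InArm d b (inj₁ (_ , lo , hi)) = lo , hi
  Hits⇒InArm d b (inj₂ (_ , lo , hi)) = <⇒≤ lo , hi

  module Matching (D : List Piece) (PD : PieceDecomp F 0 (length F) D) where

    Pieces : List Piece
    Pieces = deduplicate _≟Piece_ D

    Unique-Pieces : Unique Pieces
    Unique-Pieces = deduplicate-! _≟Piece_ D

    Unhit : List Piece
    Unhit = filter (¬? ∘ hit?) Pieces

    ∈-Unhit⁻ : ∀ {d} → d ∈ Unhit → d ∈ D × ¬ Hit d
    ∈-Unhit⁻ m = let (d∈ , ¬hit) = ∈-filter⁻ (¬? ∘ hit?) m in ∈-deduplicate⁻ _≟Piece_ D d∈ , ¬hit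

    image : ∀ {d} → d ∈ Unhit → Piece × Piece
    image {d} m = d , proj₁ (¬Hit⇒PerfectImage d (decomp-wellFormed F PD (proj₁ (∈-Unhit⁻ m))) (proj₂ (∈-Unhit⁻ m)))

    M : List (Piece × Piece)
    M = mapWith∈ Unhit image

    ∈-M⁻ : ∀ {f g} → (f , g) ∈ M → f ∈ D × ¬ Hit f × PerfectMatch F G P f g × IsPiece G g × Image f g
    ∈-M⁻ m with mapWith∈⁻ Unhit image m
    ... | d , d∈ , refl =
      let (d∈D , ¬hit) = ∈-Unhit⁻ d∈ in d∈D , ¬hit , proj₂ (¬Hit⇒PerfectImage d (decomp-wellFormed F PD d∈D) ¬hit)

    ∈-M⁺ : ∀ {d} → d ∈ D → ¬ Hit d → ∃ λ g → (d , g) ∈ M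
    ∈-M⁺ d∈D ¬hit =
      let d∈ = ∈-filter⁺ (¬? ∘ hit?) (∈-deduplicate⁺ _≟Piece_ d∈D) ¬hit in
      proj₂ (image d∈) , mapWith∈⁺ image (_ , d∈ , refl)

    Unique-domain : Unique (map proj₁ M)
    Unique-domain = subst Unique (sym (trans (map-mapWith∈ Unhit image proj₁) (mapWith∈-id Unhit)))
                      (Unique-filter⁺ (¬? ∘ hit?) Unique-Pieces)

    IsPieceMatching-M : IsPieceMatching F G k D M
    IsPieceMatching-M = (λ m → let (f∈ , _ , _ , g-piece , _) = ∈-M⁻ m in f∈ , g-piece) , Unique-domain ,
                        P , isA , width≤2k , (λ m → proj₁ (proj₂ (proj₂ (∈-M⁻ m))))

    Costly : ℕ → Set
    Costly n = n < L × cost n ≡ 1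

    HitBy : Piece → ℕ → Set
    HitBy u n = u ∈ D × ∃ λ b → Hits (arm u b) n

    HitBy-injective : ∀ {u u′ n} → HitBy u n → HitBy u′ n → u ≡ u′
    HitBy-injective {u} {u′} (u∈ , b , h) (u′∈ , b′ , h′) =
      proj₁ (decomp-disjoint F PD u∈ u′∈ (Hits⇒InArm u b h) (Hits⇒InArm u′ b′ h′))

    Hit-pieces : List Piece
    Hit-pieces = filter hit? Pieces

    unmatched⇒∈-Hit-pieces : ∀ d → d ∈ D → d ∉ map proj₁ M → d ∈ Hit-pieces
    unmatched⇒∈-Hit-pieces d d∈ d∉ with hit? d
    ... | yes hit = ∈-filter⁺ hit? (∈-deduplicate⁺ _≟Piece_ d∈) hit
    ... | no ¬hit = ⊥-elim (d∉ (∈-map⁺ proj₁ (proj₂ (∈-M⁺ d∈ ¬hit))))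

    length-Hit-pieces≤2k : length Hit-pieces ≤ 2 * k
    length-Hit-pieces≤2k =
      ≤-trans (Pigeonhole.length≤sumBelow Costly HitBy HitBy-injective L cost Hit-pieces
                 (Unique-filter⁺ hit? Unique-Pieces) coded (λ c → c))
              total-cost≤2k
      where
      coded : ∀ {u} → u ∈ Hit-pieces → ∃ λ n → Costly n × HitBy u n
      coded m with ∈-filter⁻ hit? m
      ... | u∈ , (n , n<L , c≡1 , b , h) = n , (n<L , c≡1) , ∈-deduplicate⁻ _≟Piece_ D u∈ , b , h

    Uncovered? : ∀ y → Dec (Uncovered M y)
    Uncovered? y with any? (λ fg → InPiece? y (proj₂ fg)) M
    ... | yes covered = no (λ u → let (_ , m , y∈) = find covered in u m y∈)
    ... | no ¬covered = yes (λ m y∈ → ¬covered (lose m y∈))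

    covered⇒preimage : ∀ {y} → ¬ Uncovered M y →
                       ∃ λ d → d ∈ D × ¬ Hit d × ∃ λ b → ∃ λ x → InArm d b x × Aligned P x y
    covered⇒preimage {y} ¬un with Uncovered? y
    ... | yes un = ⊥-elim (¬un un)
    ... | no  _ with any? (λ fg → InPiece? y (proj₂ fg)) M
    ...   | no ¬covered = ⊥-elim (¬un (λ m y∈ → ¬covered (lose m y∈)))
    ...   | yes covered with find covered
    ...     | (f , g) , m , y∈ = let (f∈ , ¬hit , _ , _ , onto , _) = ∈-M⁻ m in f , f∈ , ¬hit , onto y y∈

    unhit-image-covered : ∀ {d b x y} → d ∈ D → ¬ Hit d → InArm d b x → Aligned P x y → ¬ Uncovered M y
    unhit-image-covered {b = b} {x} {y} d∈ ¬hit x∈ al un with ∈-M⁺ d∈ ¬hit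
    ... | g , m = let (_ , _ , _ , _ , _ , into) = ∈-M⁻ m in un m (into b x y x∈ al)

    module Gaps = Runs Uncovered? (length G)

    AfterUnhit : ℕ → Set
    AfterUnhit m = X m ≡ 0 ⊎ ∃ λ d → ∃ λ b → ∃ λ x → d ∈ D × ¬ Hit d × InArm d b x × X m ≡ suc x

    step-into-gap : ∀ {y} → y < length G → (y ≡ 0 ⊎ ∃ λ y′ → y ≡ suc y′ × ¬ Uncovered M y′) →
                    ∃ λ m → m < L × Y m ≡ y × AfterUnhit m
    step-into-gap y<∣G∣ (inj₁ refl) with 0 <? L
    ... | yes 0<L = 0 , 0<L , refl , inj₁ refl
    ... | no 0≮L  = ⊥-elim (<-irrefl (sym (trans (sym Y-end) (cong Y (n≤0⇒n≡0 (≮⇒≥ 0≮L))))) y<∣G∣)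
    step-into-gap y<∣G∣ (inj₂ (y′ , refl , covered)) with covered⇒preimage covered
    ... | d , d∈ , ¬hit , b , x , x∈ , al with aligned⇒AlignedAt al
    ... | n , n<L , sn , refl , refl with suc n <? L
    ... | yes 1+n<L = suc n , 1+n<L , ali⇒Y-suc n<L sn , inj₂ (d , b , X n , d∈ , ¬hit , x∈ , ali⇒X-suc n<L sn)
    ... | no 1+n≮L  = ⊥-elim (<-irrefl (trans (sym (ali⇒Y-suc n<L sn)) (trans (cong Y (≤-antisym n<L (≮⇒≥ 1+n≮L))) Y-end)) y<∣G∣)

    AfterUnhit-not-inside-Hit : ∀ {m u b} → AfterUnhit m → u ∈ D → Hit u →
                                proj₁ (arm u b) < X m → X m < proj₂ (arm u b) → ⊥
    AfterUnhit-not-inside-Hit (inj₁ x≡0) _ _ lo _ = n≮0 (subst (_ <_) x≡0 lo)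
    AfterUnhit-not-inside-Hit {m} {u} {b} (inj₂ (d , bd , x , d∈ , ¬hit , x∈ , x≡)) u∈ hit lo hi
      with decomp-disjoint F PD u∈ d∈ (≤-pred (subst (_ <_) x≡ lo) , <-trans (subst (x <_) (sym x≡) (n<1+n x)) hi) x∈
    ... | refl , refl = ¬hit hit

    Costly₂ : ℕ → Set
    Costly₂ κ = κ < L + L × cost ⌊ κ /2⌋ ≡ 1

    InsertCharge HitCharge Charge : ℕ → ℕ → Set
    InsertCharge y κ = ∃ λ m → κ ≡ encode m false × m < L × Y m ≡ y × S m ≡ ins ×
                       (∀ {u b} → u ∈ D → ¬ Hits (arm u b) m)
    HitCharge y κ = ∃ λ u → ∃ λ b → ∃ λ n → ∃ λ m → κ ≡ encode n b × HitBy u n ×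
                    m < L × Y m ≡ y × Δx (S m) ≡ 1 × X m ≡ proj₁ (arm u b)
    Charge y κ = InsertCharge y κ ⊎ HitCharge y κ

    Charge-injective : ∀ {y y′ κ} → Charge y κ → Charge y′ κ → y ≡ y′
    Charge-injective (inj₁ (m , refl , _ , refl , _)) (inj₁ (m′ , κ≡ , _ , refl , _))
      with encode-injective m false m′ false κ≡
    ... | refl , _ = refl
    Charge-injective (inj₂ (u , b , n , m , refl , hu , m<L , refl , Δx≡1 , xm))
                     (inj₂ (u′ , b′ , n′ , m′ , κ≡ , hu′ , m′<L , refl , Δx′≡1 , xm′))
      with encode-injective n b n′ b′ κ≡
    ... | refl , refl with HitBy-injective hu hu′
    ... | refl with X-counter.injective m m′ m<L m′<L (trans xm (sym xm′)) Δx≡1 Δx′≡1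
    ... | refl = refl
    Charge-injective (inj₁ (m , refl , _ , _ , _ , outside)) (inj₂ (u , b , n , _ , κ≡ , (u∈ , bh , h) , _))
      with encode-injective m false n b κ≡
    ... | refl , _ = ⊥-elim (outside u∈ h)
    Charge-injective (inj₂ (u , b , n , _ , refl , (u∈ , bh , h) , _)) (inj₁ (m , κ≡ , _ , _ , _ , outside))
      with encode-injective n b m false κ≡
    ... | refl , _ = ⊥-elim (outside u∈ h)

    insert-charge : ∀ {m y} → m < L → Y m ≡ y → AfterUnhit m → S m ≡ ins → ∃ λ κ → Costly₂ κ × Charge y κ
    insert-charge {m} m<L ym after sm =
      encode m false , (encode-< m false L m<L , trans (cong cost (⌊encode/2⌋ m false)) (ins⇒cost≡1 m sm)) ,
      inj₁ (m , refl , m<L , ym , sm , outside)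
      where
      outside : ∀ {u b} → u ∈ D → ¬ Hits (arm u b) m
      outside u∈ (inj₁ (Δx≡1 , _))   = 0≢1+n (trans (sym (cong Δx sm)) Δx≡1)
      outside {u} {b} u∈ (inj₂ (_ , lo , hi)) =
        AfterUnhit-not-inside-Hit {m} after u∈ (m , m<L , ins⇒cost≡1 m sm , b , inj₂ (sm , lo , hi)) lo hi

    -- A consuming step entering a gap lies in an arm of some piece u. If u were unhit, a deletion
    -- would hit it and an alignment would cover the gap; so u is hit, and the gap is charged to the
    -- step hitting u together with the arm, whose start the entering step must be.
    consume-charge : ∀ {m y} → m < L → Y m ≡ y → Uncovered M y → AfterUnhit m → S m ≡ del ⊎ S m ≡ ali →
                     ∃ λ κ → Costly₂ κ × Charge y κ
    consume-charge {m} {y} m<L ym un after del⊎ali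
      with decomp-covers F PD (X m) z≤n (consumed⇒X<∣F∣ m<L (del⊎ali⇒Δx≡1 del⊎ali))
    ... | u , bu , u∈ , xm∈ with hit? u
    ...   | no ¬hit = ⊥-elim (unhit del⊎ali)
      where
      unhit : S m ≡ del ⊎ S m ≡ ali → ⊥
      unhit (inj₁ sm) = ¬hit (m , m<L , del⇒cost≡1 m sm , bu , inj₁ (cong Δx sm , xm∈))
      unhit (inj₂ sm) = unhit-image-covered u∈ ¬hit xm∈ (AlignedAt⇒aligned (m<L , sm , refl , refl))
                          (subst (Uncovered M) (sym ym) un)
    ...   | yes hit@(n , n<L , c≡1 , b , h) =
      encode n bu , (encode-< n bu L n<L , trans (cong cost (⌊encode/2⌋ n bu)) c≡1) ,
      inj₂ (u , bu , n , m , refl , (u∈ , b , h) , m<L , ym , del⊎ali⇒Δx≡1 del⊎ali , at-start)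
      where
      at-start : X m ≡ proj₁ (arm u bu)
      at-start = ≤-antisym (≮⇒≥ λ lo → AfterUnhit-not-inside-Hit {m} after u∈ hit lo (proj₂ xm∈)) (proj₁ xm∈)

    gap-start-charged : ∀ {y} → y ∈ Gaps.starts → ∃ λ κ → Costly₂ κ × Charge y κ
    gap-start-charged y∈ with Gaps.∈-starts⁻ y∈
    ... | y<∣G∣ , un , start with step-into-gap y<∣G∣ start
    ... | m , m<L , ym , after with S m in sm
    ... | ins = insert-charge m<L ym after sm
    ... | del = consume-charge m<L ym un after (inj₁ sm)
    ... | ali = consume-charge m<L ym un after (inj₂ sm)

    length-starts≤4k : length Gaps.starts ≤ 4 * k
    length-starts≤4k = begin
      length Gaps.starts                         ≤⟨ Pigeonhole.length≤sumBelow Costly₂ Charge Charge-injective (L + L)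
                                                      (cost ∘ ⌊_/2⌋) Gaps.starts Gaps.Unique-starts gap-start-charged (λ c → c) ⟩
      sumBelow (L + L) (cost ∘ ⌊_/2⌋)            ≡⟨ sumBelow-⌊/2⌋ L cost ⟩
      sumBelow L cost + sumBelow L cost          ≤⟨ +-mono-≤ total-cost≤2k total-cost≤2k ⟩
      2 * k + 2 * k                              ≡⟨ sym (*-distribʳ-+ k 2 2) ⟩
      4 * k                                      ∎
      where open ≤-Reasoning

lemma35 : {A : Set} (_≟_ : DecidableEquality A) (F G : List (Paren A)) (k : ℕ) →
    Bal F → Bal G → TedAtMost _≟_ F G k →
    (D : List Piece) → PieceDecomp F 0 (length F) D →
    Σ (List (Piece × Piece)) λ M → IsPieceMatching F G k D M ×
      Σ (List Piece) (λ U → length U ≤ 2 * k ×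
        (∀ d → d ∈ D → d ∉ map proj₁ M → d ∈ U)) ×
      Σ (List (ℕ × ℕ)) (λ I → length I ≤ 4 * k ×
        (∀ y → y < length G → (Uncovered M y ⇔ InSomeFragment y I)))
lemma35 _≟_ F G k BF BG (P , isA , cost≤) D PD =
  M , IsPieceMatching-M ,
  (Hit-pieces , length-Hit-pieces≤2k , unmatched⇒∈-Hit-pieces) ,
  (Gaps.fragments , subst (_≤ 4 * k) (sym (length-map _ Gaps.starts)) length-starts≤4k , Gaps.Un⇔InSomeFragment)
  where
  open Alignment _≟_ F G k BF BG P isA cost≤
  open Matching D PD
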